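{- Let $\lambda$ be a partition, $\pi$ a reverse plane partition of shape $\lambda$ and $h$ a rim-hook of $\lambda$ that does not insert into $\pi$. Then there exists a candidate $u\in\mathrm{cand}(\pi)$ with $u\triangleleft\alpha(P(h,\pi))$.
   Context: Cells are pairs $(i,j)\in\mathbb Z^2$; $\mathrm n(i,j)=(i-1,j)$, $\mathrm e(i,j)=(i,j+1)$, $\mathrm s(i,j)=(i+1,j)$, $\mathrm w(i,j)=(i,j-1)$. A partition $\lambda$ is identified with its Young diagram. A reverse plane partition of shape $\lambda$ is $\pi:\lambda\to\mathbb N$ with $\pi(u)\le\pi(\mathrm e u),\pi(\mathrm s u)$, with conventions $\pi(i,j)=0$ if $i\le0$ or $j\le0$, $\pi(i,j)=\infty$ if $i,j\ge1$, $(i,j)\notin\lambda$. Content $c(i,j)=j-i$; outer corner: $u\in\lambda$, $\mathrm e u,\mathrm s u\notin\lambda$; inner corner: $\mathrm e u,\mathrm s u\in\lambda$, $\mathrm e\mathrm s u\notin\lambda$. With inner corner contents $i_1<\dots<i_r$ and outer corner contents $o_1<\dots<o_{r+1}$ (interlacing), $\mathcal I=\{u\in\lambda:c(u)=i_k\}$, $\mathcal O=\{u\in\lambda:c(u)=o_k\}$, $\mathcal A=\{u\in\lambda:c(u)<o_1\text{ or }i_k<c(u)<o_{k+1}\text{ for some }k\in[r]\}$, $\mathcal B=\{u\in\lambda:o_k<c(u)<i_k\text{ for some }k\in[r]\text{ or }c(u)>o_{r+1}\}$. Content order: $(i,j)\trianglelefteq(k,l)$ iff $j-i>l-k$, or $j-i=l-k$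 and $i\ge k$; $\triangleleft$ is the strict version. Candidates: $\mathrm{cand}(\pi)=\{u\in\mathcal O:\pi(u)>\pi(\mathrm w u)\}\cup\{u\in\mathcal A:\pi(u)>\pi(\mathrm w u),\pi(u)>\pi(\mathrm n u)\}$. North-east path: $(u_0,\dots,u_s)$ in $\lambda$ with $u_k\in\{\mathrm n u_{k-1},\mathrm e u_{k-1}\}$, length $s$, head $\alpha=u_0$, tail $\omega=u_s$. South-west path: $(v_0,\dots,v_s)$ with $v_k\in\{\mathrm s v_{k-1},\mathrm w v_{k-1}\}$, length $s$, $\alpha=v_s$, $\omega=v_0$. Rim-hook of $\lambda$: north-east path $h$ with $\mathrm s\alpha(h)\notin\lambda$, $\mathrm e\omega(h)\notin\lambda$, $\mathrm e\mathrm s u\notin\lambda$ for all $u\in h$. $(\pi+P)(u)=\pi(u)+1$ for $u\in P$, else $\pi(u)$. $(P,\pi)$ compatible: $u\in P\cap(\mathcal I\cup\mathcal A)$ implies $\mathrm e u\in P$ and $\pi(u)=\pi(\mathrm e u)$; $u,\mathrm s u\in P$ implies $\pi(u)=\pi(\mathrm s u)$. $h$ inserts into $\pi$ if some path $P$ has $\omega(P)=\omega(h)$, $\ell(P)=\ell(h)$, $(P,\pi)$ compatible and $\pi+P$ a reverse plane partition. $P(h,\pi)$: the south-west path starting at $\omega(h)$ which, while its length is less than $\ell(h)$, moves from current cell $u$ to $\mathrm s u$ if $u\in\mathcal B\cup\mathcal I$ and $\pi(u)=\pi(\mathrm s u)$, and to $\mathrm w u$ otherwise. -}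

module Defs where

open import Data.Nat as ℕ using (ℕ; zero; suc)
open import Data.Integer as ℤ using (ℤ; +_; _-_)
import Data.Integer.Properties as ℤP
open import Data.Bool using (Bool; true; false; if_then_else_; _∨_; _∧_)
open import Data.List using (List; []; _∷_; _++_; map; length; filter)
open import Data.List.Relation.Unary.All using (All)
open import Data.List.Relation.Unary.Linked using (Linked)
open import Data.List.Membership.Propositional using (_∈_)
open import Data.Product using (Σ; _×_; _,_; proj₁; proj₂; ∃-syntax)
import Data.Product.Properties as ×P
open import Data.Sum using (_⊎_)
open import Data.Empty using (⊥)
open import Relation.Nullary using (¬_; Dec; yes; no; does)
open import Relation.Nullary.Decidable using (_×-dec_; ¬?)
open import Relation.Binary.PropositionalEquality using (_≡_; _≢_)
open import Relation.Binary.Definitions using (DecidableEquality)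
import Data.List.Sort

Cell : Set
Cell = ℤ × ℤ

n e s w : Cell → Cell
n (i , j) = (i - + 1 , j)
e (i , j) = (i , j ℤ.+ + 1)
s (i , j) = (i ℤ.+ + 1 , j)
w (i , j) = (i , j - + 1)

content : Cell → ℤ
content (i , j) = j - i

_≟ᶜ_ : DecidableEquality Cell
_≟ᶜ_ = ×P.≡-dec ℤ._≟_ ℤ._≟_

IsPartition : List ℕ → Set
IsPartition λ′ = All (ℕ._<_ 0) λ′ × Linked ℕ._≥_ λ′

-- length of row i (0 for i ≤ 0 or i beyond the number of parts)
rowLen : List ℕ → ℤ → ℕ
rowLen [] _ = 0
rowLen (p ∷ ps) (+ zero) = 0
rowLen (p ∷ ps) (+ suc zero) = p
rowLen (p ∷ ps) (+ suc (suc k)) = rowLen ps (+ suc k)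
rowLen (p ∷ ps) ℤ.-[1+ _ ] = 0

_∈λ_ : Cell → List ℕ → Set
(i , j) ∈λ λ′ = (+ 1 ℤ.≤ j) × (j ℤ.≤ + rowLen λ′ i)

_∈λ?_ : (u : Cell) → (λ′ : List ℕ) → Dec (u ∈λ λ′)
(i , j) ∈λ? λ′ with (+ 1) ℤ.≤? j | j ℤ.≤? (+ rowLen λ′ i)
... | yes p | yes q = yes (p , q)
... | no ¬p | _ = no (λ pq → ¬p (proj₁ pq))
... | yes _ | no ¬q = no (λ pq → ¬q (proj₂ pq))

cellsFrom : ℕ → List ℕ → List Cell
cellsFrom i [] = []
cellsFrom i (p ∷ ps) = map (λ j → (+ i , + suc j)) (Data.List.upTo p) ++ cellsFrom (suc i) ps

cellsOf : List ℕ → List Cell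
cellsOf = cellsFrom 1

OuterCorner : List ℕ → Cell → Set
OuterCorner λ′ u = u ∈λ λ′ × ¬ (e u ∈λ λ′) × ¬ (s u ∈λ λ′)

InnerCorner : List ℕ → Cell → Set
InnerCorner λ′ u = e u ∈λ λ′ × s u ∈λ λ′ × ¬ (e (s u) ∈λ λ′)

outer? : (λ′ : List ℕ) → (u : Cell) → Dec (OuterCorner λ′ u)
outer? λ′ u = (u ∈λ? λ′) ×-dec (¬? (e u ∈λ? λ′) ×-dec ¬? (s u ∈λ? λ′))

inner? : (λ′ : List ℕ) → (u : Cell) → Dec (InnerCorner λ′ u)
inner? λ′ u = (e u ∈λ? λ′) ×-dec ((s u ∈λ? λ′) ×-dec ¬? (e (s u) ∈λ? λ′))

open Data.List.Sort ℤP.≤-decTotalOrder using (sort)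

-- i_1 < ... < i_r  (inner corner contents, increasing)
innerContents : List ℕ → List ℤ
innerContents λ′ = sort (map content (filter (inner? λ′) (cellsOf λ′)))

-- o_1 < ... < o_{r+1}  (outer corner contents, increasing)
outerContents : List ℕ → List ℤ
outerContents λ′ = sort (map content (filter (outer? λ′) (cellsOf λ′)))

At : List ℤ → ℕ → ℤ → Set
At [] _ _ = ⊥
At (x ∷ xs) zero y = x ≡ y
At (x ∷ xs) (suc k) y = At xs k y

-- The sets I, O, A, B  (0-based indices: i_{k+1} = At is k, o_{k+1} = At os k)

inI : List ℕ → Cell → Set
inI λ′ u = u ∈λ λ′ × content u ∈ innerContents λ′

inO : List ℕ → Cell → Set
inO λ′ u = u ∈λ λ′ × content u ∈ outerContents λ′

inA : List ℕ → Cell → Set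
inA λ′ u = u ∈λ λ′ ×
  ( (Σ ℤ λ o → At (outerContents λ′) 0 o × content u ℤ.< o)
  ⊎ (Σ ℕ λ k → Σ ℤ λ a → Σ ℤ λ b →
       At (innerContents λ′) k a × At (outerContents λ′) (suc k) b ×
       a ℤ.< content u × content u ℤ.< b) )

inB : List ℕ → Cell → Set
inB λ′ u = u ∈λ λ′ ×
  ( (Σ ℕ λ k → Σ ℤ λ a → Σ ℤ λ b →
       At (outerContents λ′) k a × At (innerContents λ′) k b ×
       a ℤ.< content u × content u ℤ.< b)
  ⊎ (Σ ℤ λ o → At (outerContents λ′) (length (innerContents λ′)) o × o ℤ.< content u) )

_⊴_ : Cell → Cell → Set
(i , j) ⊴ (k , l) = (l - k ℤ.< j - i) ⊎ ((j - i ≡ l - k) × (k ℤ.≤ i))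

_◁_ : Cell → Cell → Set
u ◁ v = u ⊴ v × u ≢ v

data ℕ∞ : Set where
  fin : ℕ → ℕ∞
  ∞   : ℕ∞

data _≤∞_ : ℕ∞ → ℕ∞ → Set where
  fin≤fin : ∀ {a b} → a ℕ.≤ b → fin a ≤∞ fin b
  _≤∞∞    : ∀ x → x ≤∞ ∞

data _<∞_ : ℕ∞ → ℕ∞ → Set where
  fin<fin : ∀ {a b} → a ℕ.< b → fin a <∞ fin b
  fin<∞   : ∀ {a} → fin a <∞ ∞

-- π is a function on all cells; only its values on λ matter.
-- Extended value with the conventions: 0 if i ≤ 0 or j ≤ 0,
-- ∞ if i, j ≥ 1 and (i , j) ∉ λ.
ev : List ℕ → (Cell → ℕ) → Cell → ℕ∞
ev λ′ π (i , j) with i ℤ.≤? + 0 | j ℤ.≤? + 0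
... | yes _ | _ = fin 0
... | no _ | yes _ = fin 0
... | no _ | no _ with (i , j) ∈λ? λ′
...   | yes _ = fin (π (i , j))
...   | no _ = ∞

IsRPP : List ℕ → (Cell → ℕ) → Set
IsRPP λ′ π = ∀ u → u ∈λ λ′ → (fin (π u) ≤∞ ev λ′ π (e u)) × (fin (π u) ≤∞ ev λ′ π (s u))

Cand : List ℕ → (Cell → ℕ) → Cell → Set
Cand λ′ π u =
    (inO λ′ u × ev λ′ π (w u) <∞ ev λ′ π u)
  ⊎ (inA λ′ u × ev λ′ π (w u) <∞ ev λ′ π u × ev λ′ π (n u) <∞ ev λ′ π u)

-- North-east paths: a path (u₀ , [u₁ , … , u_s]) lists its cells
-- from head α = u₀ to tail ω = u_s.

Path : Set
Path = Cell × List Cell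

cells : Path → List Cell
cells (u , us) = u ∷ us

len : Path → ℕ
len (u , us) = length us

α : Path → Cell
α (u , us) = u

lastOf : Cell → List Cell → Cell
lastOf u [] = u
lastOf u (v ∷ vs) = lastOf v vs

ω : Path → Cell
ω (u , us) = lastOf u us

NEStep : Cell → Cell → Set
NEStep u v = (v ≡ n u) ⊎ (v ≡ e u)

IsNEPath : List ℕ → Path → Set
IsNEPath λ′ P = All (_∈λ λ′) (cells P) × Linked NEStep (cells P)

IsRimHook : List ℕ → Path → Set
IsRimHook λ′ h = IsNEPath λ′ h × ¬ (s (α h) ∈λ λ′) × ¬ (e (ω h) ∈λ λ′)
               × All (λ u → ¬ (e (s u) ∈λ λ′)) (cells h)

open import Data.List.Membership.DecPropositional _≟ᶜ_ using () renaming (_∈?_ to _∈ᶜ?_)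

addPath : (Cell → ℕ) → Path → Cell → ℕ
addPath π P u with u ∈ᶜ? cells P
... | yes _ = suc (π u)
... | no _ = π u

Compatible : List ℕ → Path → (Cell → ℕ) → Set
Compatible λ′ P π =
    (∀ u → u ∈ cells P → (inI λ′ u ⊎ inA λ′ u) → (e u ∈ cells P) × (π u ≡ π (e u)))
  × (∀ u → u ∈ cells P → s u ∈ cells P → π u ≡ π (s u))

Inserts : List ℕ → (Cell → ℕ) → Path → Set
Inserts λ′ π h = Σ Path λ P →
  IsNEPath λ′ P × ω P ≡ ω h × len P ≡ len h × Compatible λ′ P π × IsRPP λ′ (addPath π P)

-- The south-west path P(h, π): SWWalk λ π m u v means that the walk
-- starting at u and performing m steps (south if the current cell is in
-- B ∪ I and π(u) = π(s u), west otherwise) ends at v.  Thus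
-- α(P(h,π)) is the v with SWWalk λ π (len h) (ω h) v.

DownOK : List ℕ → (Cell → ℕ) → Cell → Set
DownOK λ′ π u = (inB λ′ u ⊎ inI λ′ u) × (ev λ′ π u ≡ ev λ′ π (s u))

data SWWalk (λ′ : List ℕ) (π : Cell → ℕ) : ℕ → Cell → Cell → Set where
  stop  : ∀ {u} → SWWalk λ′ π 0 u u
  south : ∀ {m u v} → DownOK λ′ π u → SWWalk λ′ π m (s u) v → SWWalk λ′ π (suc m) u v
  west  : ∀ {m u v} → ¬ DownOK λ′ π u → SWWalk λ′ π m (w u) v → SWWalk λ′ π (suc m) u v

-- For each diagonal of λ let its rim cell r be its last cell in λ (e (s r) ∉ λ). Outer and
-- inner corner contents interlace, which lets one read off the class of a diagonal from r:
-- it lies in O, I, A or B according as neither, both, only e r, or only s r lie in λ.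
--
-- Since λ is finite, either some cell is a candidate u ◁ a = α(P(h, π)), or none is. In the
-- latter case, on a diagonal of O ∪ A before a the filling cannot increase westwards: such
-- an ascent would travel north along equal entries until it produced a candidate. Following
-- the walk P(h, π) from ω(h) to a, this yields at each of its cells the conditions making P
-- compatible with π and π + P a reverse plane partition, so h would insert into π.

module Submission where

open import Defs
open import Level using (0ℓ)
open import Data.Nat as ℕ using (ℕ; zero; suc; z≤n; s≤s)
import Data.Nat.Properties as ℕP
import Data.Nat.Tactic.RingSolver as ℕS
open import Data.Integer as ℤ
  using (ℤ; +_; -[1+_]; _+_; _-_; -_; _≤_; _<_; _≤?_; _<?_; +≤+; +<+; -≤+; ∣_∣)
import Data.Integer.Properties as ℤP
open import Data.Integer.Tactic.RingSolver using (solve-∀)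
open import Data.List using (List; []; _∷_; _++_; [_]; map; length; filter; upTo)
open import Data.List.Properties using (length-++; length-filter; filter-none; filter-notAll)
open import Data.List.Relation.Unary.Linked using (Linked; []; [-]; _∷_)
open import Data.List.Relation.Unary.All as All using (All; []; _∷_)
open import Data.List.Relation.Unary.Any using (here; there; any?; satisfied)
open import Data.List.Relation.Unary.Unique.Propositional using (Unique)
import Data.List.Relation.Unary.Unique.Propositional.Properties as Uniqueₚ
open import Data.List.Relation.Unary.AllPairs using ([]; _∷_)
open import Data.List.Membership.Propositional using (_∈_; _∉_; lose)
open import Data.List.Membership.Propositional.Properties
  using (∈-map⁺; ∈-map⁻; ∈-filter⁺; ∈-filter⁻; ∈-++⁺ˡ; ∈-++⁺ʳ; ∈-++⁻; ∈-upTo⁺; ∈-length)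
open import Data.List.Membership.DecPropositional _≟ᶜ_ using () renaming (_∈?_ to _∈ᶜ?_)
open import Data.List.Membership.DecPropositional ℤ._≟_ using () renaming (_∈?_ to _∈ℤ?_)
open import Data.List.Relation.Binary.Permutation.Propositional using (_↭_; ↭-sym)
open import Data.List.Relation.Binary.Permutation.Propositional.Properties
  using (filter-↭; ↭-length; ∈-resp-↭)
open import Data.List.Sort ℤP.≤-decTotalOrder using (sort; sort-↭; sort-↗)
open import Data.Product using (Σ; _×_; _,_; proj₁; proj₂)
open import Data.Sum using (_⊎_; inj₁; inj₂; [_,_]′)
open import Data.Empty using (⊥; ⊥-elim)
open import Relation.Nullary using (¬_; Dec; yes; no)
open import Relation.Nullary.Decidable using (_×-dec_; _⊎-dec_; ¬?)
open import Relation.Unary using (Pred; Decidable)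
open import Relation.Binary using (tri<; tri≈; tri>)
open import Relation.Binary.PropositionalEquality hiding ([_])

<⇒+1≤ : ∀ {a b} → a < b → a + + 1 ≤ b
<⇒+1≤ {a} p = subst (_≤ _) (ℤP.+-comm (+ 1) a) (ℤP.i<j⇒suc[i]≤j p)

+1≤⇒< : ∀ {a b} → a + + 1 ≤ b → a < b
+1≤⇒< {a} p = ℤP.suc[i]≤j⇒i<j (subst (_≤ _) (ℤP.+-comm a (+ 1)) p)

i≤i+1 : ∀ i → i ≤ i + + 1
i≤i+1 i = ℤP.i≤i+j i (+ 1)

i-1≤i : ∀ i → i - + 1 ≤ i
i-1≤i i = ℤP.i-j≤i i (+ 1)

i<i+1 : ∀ i → i < i + + 1
i<i+1 i = +1≤⇒< ℤP.≤-refl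

i+1-1≡i : ∀ i → (i + + 1) - + 1 ≡ i
i+1-1≡i = solve-∀

i-1+1≡i : ∀ i → (i - + 1) + + 1 ≡ i
i-1+1≡i = solve-∀

¬1≤⇒≤0 : ∀ {i} → ¬ (+ 1 ≤ i) → i ≤ + 0
¬1≤⇒≤0 {+ zero}   _   = ℤP.≤-refl
¬1≤⇒≤0 {+ suc k}  ¬p = ⊥-elim (¬p (+≤+ (s≤s z≤n)))
¬1≤⇒≤0 { -[1+ k ]} _  = -≤+

i≤+∣i∣ : ∀ i → i ≤ + ∣ i ∣
i≤+∣i∣ (+ _)    = ℤP.≤-refl
i≤+∣i∣ -[1+ _ ] = -≤+

1≤⇒≡+suc : ∀ {i} → + 1 ≤ i → Σ ℕ λ a → i ≡ + suc a
1≤⇒≡+suc (+≤+ {n = suc a} (s≤s _)) = a , refl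

row col : Cell → ℤ
row = proj₁
col = proj₂

n-s : ∀ u → n (s u) ≡ u
n-s (i , j) = cong (_, j) (i+1-1≡i i)

s-n : ∀ u → s (n u) ≡ u
s-n (i , j) = cong (_, j) (i-1+1≡i i)

w-e : ∀ u → w (e u) ≡ u
w-e (i , j) = cong (i ,_) (i+1-1≡i j)

e-w : ∀ u → e (w u) ≡ u
e-w (i , j) = cong (i ,_) (i-1+1≡i j)

content-n : ∀ u → content (n u) ≡ content u + + 1
content-n (i , j) = identity i j
  where identity : ∀ i j → j - (i - + 1) ≡ (j - i) + + 1
        identity = solve-∀

content-e : ∀ u → content (e u) ≡ content u + + 1
content-e (i , j) = identity i j
  where identity : ∀ i j → (j + + 1) - i ≡ (j - i) + + 1
        identity = solve-∀

content-s : ∀ u → content (s u) ≡ content u - + 1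
content-s (i , j) = identity i j
  where identity : ∀ i j → j - (i + + 1) ≡ (j - i) - + 1
        identity = solve-∀

content-w : ∀ u → content (w u) ≡ content u - + 1
content-w (i , j) = identity i j
  where identity : ∀ i j → (j - + 1) - i ≡ (j - i) - + 1
        identity = solve-∀

content-es : ∀ u → content (e (s u)) ≡ content u
content-es (i , j) = identity i j
  where identity : ∀ i j → (j + + 1) - (i + + 1) ≡ j - i
        identity = solve-∀

content-s+1 : ∀ u → content (s u) + + 1 ≡ content u
content-s+1 u = trans (cong (_+ + 1) (content-s u)) (i-1+1≡i (content u))

content-w+1 : ∀ u → content (w u) + + 1 ≡ content u
content-w+1 u = trans (cong (_+ + 1) (content-w u)) (i-1+1≡i (content u))

content-s<content : ∀ u → content (s u) < content u
content-s<content u = subst (content (s u) <_) (content-s+1 u) (i<i+1 (content (s u)))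

content-w<content : ∀ u → content (w u) < content u
content-w<content u = subst (content (w u) <_) (content-w+1 u) (i<i+1 (content (w u)))

row≡col-content : ∀ u → row u ≡ col u - content u
row≡col-content (i , j) = identity i j
  where identity : ∀ i j → i ≡ j - (j - i)
        identity = solve-∀

col≡content+row : ∀ u → col u ≡ content u + row u
col≡content+row (i , j) = identity i j
  where identity : ∀ i j → j ≡ (j - i) + i
        identity = solve-∀

-- Young diagrams

rowLen-head : ∀ p ps b → Linked ℕ._≥_ (p ∷ ps) → rowLen (p ∷ ps) (+ suc b) ℕ.≤ p
rowLen-head p ps       zero    _          = ℕP.≤-refl
rowLen-head p []       (suc b) _          = z≤n
rowLen-head p (q ∷ qs) (suc b) (p≥q ∷ lk) = ℕP.≤-trans (rowLen-head q qs b lk) p≥q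

rowLen-antitone : ∀ L → Linked ℕ._≥_ L → ∀ {a b} → a ℕ.≤ b → rowLen L (+ suc b) ℕ.≤ rowLen L (+ suc a)
rowLen-antitone []           _        _         = z≤n
rowLen-antitone (p ∷ ps)     lk       {zero}  {b} _ = rowLen-head p ps b lk
rowLen-antitone (p ∷ [])     _        {suc a} {suc b} _ = z≤n
rowLen-antitone (p ∷ q ∷ qs) (_ ∷ lk) {suc a} {suc b} (s≤s a≤b) = rowLen-antitone (q ∷ qs) lk a≤b

rowLen-nonpos : ∀ L i → i ≤ + 0 → rowLen L i ≡ 0
rowLen-nonpos []       i          _         = refl
rowLen-nonpos (p ∷ ps) (+ zero)   _         = refl
rowLen-nonpos (p ∷ ps) (+ suc k)  (+≤+ ())
rowLen-nonpos (p ∷ ps) -[1+ k ]   _         = refl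

rowLen-beyond : ∀ L a → length L ℕ.≤ a → rowLen L (+ suc a) ≡ 0
rowLen-beyond []       a       _       = refl
rowLen-beyond (p ∷ ps) (suc a) (s≤s q) = rowLen-beyond ps a q

∈λ⇒1≤row : ∀ L {u} → u ∈λ L → + 1 ≤ row u
∈λ⇒1≤row L {i , j} (1≤j , j≤len) with + 1 ≤? i
... | yes 1≤i = 1≤i
... | no  1≰i with ℤP.≤-trans 1≤j (subst (λ k → j ≤ + k) (rowLen-nonpos L i (¬1≤⇒≤0 1≰i)) j≤len)
...   | +≤+ ()

∈λ⇒row≤length : ∀ L {a j} → (+ suc a , j) ∈λ L → suc a ℕ.≤ length L
∈λ⇒row≤length L {a} (1≤j , j≤len) with length L ℕ.≤? a
... | no  ¬le = ℕP.≰⇒> ¬le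
... | yes le with ℤP.≤-trans 1≤j (subst (λ k → _ ≤ + k) (rowLen-beyond L a le) j≤len)
...   | +≤+ ()

∈λ-downClosed : ∀ L → IsPartition L → ∀ {u v} → u ∈λ L →
                + 1 ≤ row v → row v ≤ row u → + 1 ≤ col v → col v ≤ col u → v ∈λ L
∈λ-downClosed L isP m 1≤i′ i′≤i 1≤j′ j′≤j
  with 1≤⇒≡+suc (∈λ⇒1≤row L m) | 1≤⇒≡+suc 1≤i′
... | a , refl | b , refl =
  1≤j′ , ℤP.≤-trans j′≤j (ℤP.≤-trans (proj₂ m)
                           (+≤+ (rowLen-antitone L (proj₂ isP) (ℕP.≤-pred (ℤP.drop‿+≤+ i′≤i)))))

cellsFrom-complete : ∀ k L t a → a ℕ.< rowLen L (+ suc t) → (+ (t ℕ.+ k) , + suc a) ∈ cellsFrom k L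
cellsFrom-complete k (p ∷ ps) zero    a lt = ∈-++⁺ˡ (∈-map⁺ (λ j → (+ k , + suc j)) (∈-upTo⁺ lt))
cellsFrom-complete k (p ∷ ps) (suc t) a lt =
  ∈-++⁺ʳ (map (λ j → (+ k , + suc j)) (upTo p))
    (subst (λ z → (+ z , + suc a) ∈ cellsFrom (suc k) ps) (ℕP.+-suc t k)
      (cellsFrom-complete (suc k) ps t a lt))

cellsOf-complete : ∀ L {u} → u ∈λ L → u ∈ cellsOf L
cellsOf-complete L {i , j} m with 1≤⇒≡+suc (∈λ⇒1≤row L m) | 1≤⇒≡+suc (proj₁ m)
... | t , refl | a , refl =
  subst (λ z → (+ z , + suc a) ∈ cellsOf L) (ℕP.+-comm t 1)
    (cellsFrom-complete 1 L t a (ℤP.drop‿+≤+ (proj₂ m)))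

cellsFrom-rows : ∀ k L {x} → x ∈ cellsFrom k L → Σ ℕ λ m → row x ≡ + m × k ℕ.≤ m
cellsFrom-rows k (p ∷ ps) mem with ∈-++⁻ (map (λ j → (+ k , + suc j)) (upTo p)) mem
... | inj₁ m₁ with ∈-map⁻ (λ j → (+ k , + suc j)) m₁
...   | _ , _ , refl = k , refl , ℕP.≤-refl
cellsFrom-rows k (p ∷ ps) mem | inj₂ m₂ with cellsFrom-rows (suc k) ps m₂
... | m , eq , le = m , eq , ℕP.≤-trans (ℕP.n≤1+n k) le

cellsFrom-unique : ∀ k L → Unique (cellsFrom k L)
cellsFrom-unique k []       = []
cellsFrom-unique k (p ∷ ps) =
  Uniqueₚ.++⁺ (Uniqueₚ.map⁺ (λ { refl → refl }) (Uniqueₚ.upTo⁺ p)) (cellsFrom-unique (suc k) ps) disjoint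
  where
  disjoint : ∀ {v} → ¬ (v ∈ map (λ j → (+ k , + suc j)) (upTo p) × v ∈ cellsFrom (suc k) ps)
  disjoint (m₁ , m₂) with ∈-map⁻ (λ j → (+ k , + suc j)) m₁ | cellsFrom-rows (suc k) ps m₂
  ... | _ , _ , refl | _ , refl , le = ℕP.<-irrefl refl le

module Shape (L : List ℕ) (isP : IsPartition L) where

  1≤row : ∀ {u} → u ∈λ L → + 1 ≤ row u
  1≤row = ∈λ⇒1≤row L

  1≤col : ∀ {u} → u ∈λ L → + 1 ≤ col u
  1≤col = proj₁

  ∈λ-below : ∀ {u v} → u ∈λ L → + 1 ≤ row v → row v ≤ row u → + 1 ≤ col v → col v ≤ col u → v ∈λ L
  ∈λ-below = ∈λ-downClosed L isP

  ∈λ-diagonal : ∀ {u v} → u ∈λ L → content v ≡ content u →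
                + 1 ≤ row v → row v ≤ row u → + 1 ≤ col v → v ∈λ L
  ∈λ-diagonal {u} {v} m c≡ 1≤i i≤ 1≤j = ∈λ-below m 1≤i i≤ 1≤j col≤
    where
    col≤ : col v ≤ col u
    col≤ = subst₂ _≤_ (sym (col≡content+row v)) (trans (cong (_+ row u) c≡) (sym (col≡content+row u)))
                   (ℤP.+-monoʳ-≤ (content v) i≤)

  w∈λ : ∀ {u} → u ∈λ L → + 1 ≤ col (w u) → w u ∈λ L
  w∈λ {u} m 1≤j = ∈λ-below m (1≤row m) ℤP.≤-refl 1≤j (i-1≤i (col u))

  n∈λ : ∀ {u} → u ∈λ L → + 1 ≤ row (n u) → n u ∈λ L
  n∈λ {u} m 1≤i = ∈λ-below m 1≤i (i-1≤i (row u)) (1≤col m) ℤP.≤-refl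

  es⇒s : ∀ {u} → u ∈λ L → e (s u) ∈λ L → s u ∈λ L
  es⇒s {u} m m′ = ∈λ-below m′ (1≤row m′) ℤP.≤-refl (1≤col m) (i≤i+1 (col u))

  es⇒e : ∀ {u} → u ∈λ L → e (s u) ∈λ L → e u ∈λ L
  es⇒e {u} m m′ = ∈λ-below m′ (1≤row m) (i≤i+1 (row u)) (1≤col m′) ℤP.≤-refl

  s,e⇒∈λ : ∀ {u} → s u ∈λ L → e u ∈λ L → u ∈λ L
  s,e⇒∈λ {u} ms me = ∈λ-below ms (1≤row me) (i≤i+1 (row u)) (1≤col ms) ℤP.≤-refl

  Rim : Cell → Set
  Rim r = r ∈λ L × ¬ (e (s r) ∈λ L)

  Rim-¬e : ∀ {u} → u ∈λ L → ¬ (e u ∈λ L) → Rim u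
  Rim-¬e m ¬e = m , λ p → ¬e (es⇒e m p)

  Rim-¬s : ∀ {u} → u ∈λ L → ¬ (s u ∈λ L) → Rim u
  Rim-¬s m ¬s = m , λ p → ¬s (es⇒s m p)

  rim-within : ∀ fuel {u} → u ∈λ L → length L ℕ.≤ fuel ℕ.+ ∣ row u ∣ →
               Σ Cell λ r → Rim r × content r ≡ content u
  rim-within fuel {u} m bound with e (s u) ∈λ? L
  ... | no ¬es = u , (m , ¬es) , refl
  ... | yes es with 1≤⇒≡+suc (1≤row m)
  rim-within zero {_ , j} m bound | yes es | a , refl =
    ⊥-elim (ℕP.m+1+n≰m (suc a) (ℕP.≤-trans (∈λ⇒row≤length L es) bound))
  rim-within (suc fuel) {_ , j} m bound | yes es | a , refl
    with rim-within fuel es (subst (length L ℕ.≤_) (shift fuel a) bound)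
    where shift : ∀ f a → suc f ℕ.+ suc a ≡ f ℕ.+ (suc a ℕ.+ 1)
          shift = ℕS.solve-∀
  ... | r , R , c≡ = r , R , trans c≡ (content-es (+ suc a , j))

  rim-of : ∀ {u} → u ∈λ L → Σ Cell λ r → Rim r × content r ≡ content u
  rim-of m = rim-within (length L) m (ℕP.m≤m+n _ _)

  Rim-lowest : ∀ {r v} → Rim r → v ∈λ L → content r ≡ content v → ¬ (row r < row v)
  Rim-lowest {r} (m , ¬es) mv c≡ lt =
    ¬es (∈λ-diagonal mv (trans (content-es r) c≡) (ℤP.≤-trans (1≤row m) (i≤i+1 (row r)))
                     (<⇒+1≤ lt) (ℤP.≤-trans (1≤col m) (i≤i+1 (col r))))

  Rim-unique : ∀ {r r′} → Rim r → Rim r′ → content r ≡ content r′ → r ≡ r′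
  Rim-unique {i , j} {i′ , j′} R R′ c≡ with ℤP.<-cmp i i′
  ... | tri< lt _ _ = ⊥-elim (Rim-lowest R (proj₁ R′) c≡ lt)
  ... | tri> _ _ gt = ⊥-elim (Rim-lowest R′ (proj₁ R) (sym c≡) gt)
  ... | tri≈ _ refl _ =
    cong (i ,_) (trans (col≡content+row (i , j)) (trans (cong (_+ i) c≡) (sym (col≡content+row (i , j′)))))

  Rim-e : ∀ {r} → Rim r → e r ∈λ L → Rim (e r) × ¬ (s (e r) ∈λ L)
  Rim-e (m , ¬es) me = (me , λ p → ¬es (es⇒s me p)) , ¬es

  Rim-n : ∀ {r v} → Rim r → ¬ (e r ∈λ L) → v ∈λ L → content v ≡ content r + + 1 →
          Rim (n r) × s (n r) ∈λ L
  Rim-n {r} {v} (m , _) ¬e mv c≡ =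
    (nr∈λ , subst (λ x → ¬ (e x ∈λ L)) (sym (s-n r)) ¬e) , subst (_∈λ L) (sym (s-n r)) m
    where
    nr∈λ : n r ∈λ L
    nr∈λ with + 1 ≤? row (n r)
    ... | yes 1≤i = n∈λ m 1≤i
    ... | no  1≰i = ⊥-elim (¬e (∈λ-diagonal mv (trans (content-e r) (sym c≡)) (1≤row m) er≤v
                                            (ℤP.≤-trans (1≤col m) (i≤i+1 (col r)))))
      where
      er≤v : row r ≤ row v
      er≤v = ℤP.≤-trans (subst (_≤ + 1) (i-1+1≡i (row r)) (ℤP.+-monoˡ-≤ (+ 1) (¬1≤⇒≤0 1≰i))) (1≤row mv)

  Rim-next-s⇒¬e : ∀ {r r′} → Rim r → Rim r′ → content r′ ≡ content r + + 1 → s r′ ∈λ L → ¬ (e r ∈λ L)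
  Rim-next-s⇒¬e {r} R R′ c≡ ms me with Rim-e R me
  ... | Re , ¬se with Rim-unique R′ Re (trans c≡ (sym (content-e r)))
  ... | refl = ¬se ms

  Rim-next-¬e⇒s : ∀ {r r′} → Rim r → Rim r′ → content r′ ≡ content r + + 1 → ¬ (e r ∈λ L) → s r′ ∈λ L
  Rim-next-¬e⇒s {r} R R′ c≡ ¬e with Rim-n R ¬e (proj₁ R′) c≡
  ... | Rn , sn with Rim-unique R′ Rn (trans c≡ (sym (content-n r)))
  ... | refl = sn

module _ {A : Set} where

  length-filter-map : ∀ {B : Set} {P : Pred B 0ℓ} (P? : Decidable P) (f : A → B) xs →
                      length (filter P? (map f xs)) ≡ length (filter (λ x → P? (f x)) xs)
  length-filter-map P? f []       = refl
  length-filter-map P? f (x ∷ xs) with P? (f x)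
  ... | yes _ = cong suc (length-filter-map P? f xs)
  ... | no  _ = length-filter-map P? f xs

  length-filter-↭ : ∀ {P : Pred A 0ℓ} (P? : Decidable P) {xs ys} → xs ↭ ys →
                    length (filter P? xs) ≡ length (filter P? ys)
  length-filter-↭ P? p = ↭-length (filter-↭ P? p)

  length-filter-split : ∀ {P Q R : Pred A 0ℓ} (P? : Decidable P) (Q? : Decidable Q) (R? : Decidable R) →
                        (∀ {x} → R x → P x ⊎ Q x) → (∀ {x} → P x → R x) → (∀ {x} → Q x → R x) →
                        (∀ {x} → P x → ¬ Q x) →
                        ∀ xs → length (filter R? xs) ≡ length (filter P? xs) ℕ.+ length (filter Q? xs)
  length-filter-split P? Q? R? R⇒P⊎Q P⇒R Q⇒R P⇒¬Q [] = refl
  length-filter-split P? Q? R? R⇒P⊎Q P⇒R Q⇒R P⇒¬Q (x ∷ xs) with R? x | P? x | Q? x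
  ... | yes _ | yes p | yes q = ⊥-elim (P⇒¬Q p q)
  ... | yes _ | yes _ | no  _ = cong suc ih
    where ih = length-filter-split P? Q? R? R⇒P⊎Q P⇒R Q⇒R P⇒¬Q xs
  ... | yes _ | no  _ | yes _ = trans (cong suc ih) (sym (ℕP.+-suc _ _))
    where ih = length-filter-split P? Q? R? R⇒P⊎Q P⇒R Q⇒R P⇒¬Q xs
  ... | yes r | no ¬p | no ¬q = ⊥-elim ([ ¬p , ¬q ]′ (R⇒P⊎Q r))
  ... | no ¬r | yes p | _     = ⊥-elim (¬r (P⇒R p))
  ... | no ¬r | no  _ | yes q = ⊥-elim (¬r (Q⇒R q))
  ... | no  _ | no  _ | no  _ = length-filter-split P? Q? R? R⇒P⊎Q P⇒R Q⇒R P⇒¬Q xs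

  length-filter-empty : ∀ {P : Pred A 0ℓ} (P? : Decidable P) xs → (∀ {x} → x ∈ xs → ¬ P x) →
                        length (filter P? xs) ≡ 0
  length-filter-empty P? xs none = cong length (filter-none P? (All.tabulate none))

  length-empty : ∀ xs → (∀ {x : A} → x ∉ xs) → length xs ≡ 0
  length-empty []      _    = refl
  length-empty (x ∷ _) none = ⊥-elim (none (here refl))

  Unique-constant-length≤1 : ∀ {r : A} xs → Unique xs → (∀ {y} → y ∈ xs → y ≡ r) → length xs ℕ.≤ 1
  Unique-constant-length≤1 []              _                _     = z≤n
  Unique-constant-length≤1 (x ∷ [])        _                _     = s≤s z≤n
  Unique-constant-length≤1 (x ∷ y ∷ xs) ((x≢y ∷ _) ∷ _) const =
    ⊥-elim (x≢y (trans (const (here refl)) (sym (const (there (here refl))))))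

count< : ℤ → List ℤ → ℕ
count< t xs = length (filter (_<? t) xs)

Sorted : List ℤ → Set
Sorted = Linked _≤_

Sorted-tail : ∀ {x xs} → Sorted (x ∷ xs) → Sorted xs
Sorted-tail [-]     = []
Sorted-tail (_ ∷ s) = s

Sorted-head≤At : ∀ {x xs k a} → Sorted (x ∷ xs) → At xs k a → x ≤ a
Sorted-head≤At {xs = _ ∷ _} {zero}  (x≤y ∷ _) refl = x≤y
Sorted-head≤At {xs = _ ∷ _} {suc k} (x≤y ∷ s) at   = ℤP.≤-trans x≤y (Sorted-head≤At s at)

count<-≤head : ∀ {x xs t} → Sorted (x ∷ xs) → t ≤ x → count< t (x ∷ xs) ≡ 0
count<-≤head {x} {xs} {t} s t≤x with x <? t
... | yes x<t = ⊥-elim (ℤP.<⇒≱ x<t t≤x)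
count<-≤head {xs = []}    _         t≤x | no _ = refl
count<-≤head {xs = _ ∷ _} (x≤y ∷ s) t≤x | no _ = count<-≤head s (ℤP.≤-trans t≤x x≤y)

count<-∷ : ∀ t x xs → count< t (x ∷ xs) ℕ.≤ suc (count< t xs)
count<-∷ t x xs with x <? t
... | yes _ = ℕP.≤-refl
... | no  _ = ℕP.n≤1+n _

At-exists : ∀ xs k → k ℕ.< length xs → Σ ℤ (At xs k)
At-exists (x ∷ xs) zero    _       = x , refl
At-exists (x ∷ xs) (suc k) (s≤s p) = At-exists xs k p

count<≤index : ∀ {xs k a t} → Sorted xs → At xs k a → t ≤ a → count< t xs ℕ.≤ k
count<≤index {_ ∷ _}  {zero}  s refl t≤a = ℕP.≤-reflexive (count<-≤head s t≤a)
count<≤index {x ∷ xs} {suc k} s at   t≤a =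
  ℕP.≤-trans (count<-∷ _ x xs) (s≤s (count<≤index (Sorted-tail s) at t≤a))

index<count< : ∀ {xs k a t} → Sorted xs → At xs k a → a < t → suc k ℕ.≤ count< t xs
index<count< {x ∷ xs} {k} {a} {t} s at a<t with x <? t
index<count< {x ∷ xs} {zero}  s refl a<t | no x≮t = ⊥-elim (x≮t a<t)
index<count< {x ∷ xs} {suc k} s at   a<t | no x≮t = ⊥-elim (x≮t (ℤP.≤-<-trans (Sorted-head≤At s at) a<t))
index<count< {x ∷ xs} {zero}  s refl a<t | yes _  = s≤s z≤n
index<count< {x ∷ xs} {suc k} s at   a<t | yes _  = s≤s (index<count< (Sorted-tail s) at a<t)

At-≥-from-count< : ∀ {xs k t} → Sorted xs → k ℕ.< length xs → count< t xs ℕ.≤ k →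
                   Σ ℤ λ a → At xs k a × t ≤ a
At-≥-from-count< {x ∷ xs} {k} {t} s k< c≤ with x <? t
At-≥-from-count< {x ∷ xs} {zero}  s _        ()        | yes _
At-≥-from-count< {x ∷ xs} {suc k} s (s≤s k<) (s≤s c≤) | yes _ = At-≥-from-count< (Sorted-tail s) k< c≤
At-≥-from-count< {x ∷ xs} {zero}  s _        _         | no x≮t = x , refl , ℤP.≮⇒≥ x≮t
At-≥-from-count< {x ∷ xs} {suc k} s (s≤s k<) _         | no x≮t with At-exists xs k k<
... | a , at = a , at , ℤP.≤-trans (ℤP.≮⇒≥ x≮t) (Sorted-head≤At s at)

At-<-from-count< : ∀ {xs k t} → Sorted xs → k ℕ.< count< t xs → Σ ℤ λ a → At xs k a × a < t
At-<-from-count< {x ∷ xs} {k} {t} s k< with x <? t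
At-<-from-count< {x ∷ xs} {zero}  s _        | yes x<t = x , refl , x<t
At-<-from-count< {x ∷ xs} {suc k} s (s≤s k<) | yes _   = At-<-from-count< (Sorted-tail s) k<
At-<-from-count< {x ∷ []}     {k} s k<        | no _ = ⊥-elim (ℕP.n≮0 k<)
At-<-from-count< {x ∷ y ∷ ys} {k} (x≤y ∷ s) k< | no x≮t =
  ⊥-elim (ℕP.n≮0 (subst (k ℕ.<_) (count<-≤head s (ℤP.≤-trans (ℤP.≮⇒≥ x≮t) x≤y)) k<))

module Corners (L : List ℕ) (isP : IsPartition L) where
  open Shape L isP public

  outerCells innerCells : List Cell
  outerCells = filter (outer? L) (cellsOf L)
  innerCells = filter (inner? L) (cellsOf L)

  #content< : List Cell → ℤ → ℕ
  #content< F t = length (filter (λ u → content u <? t) F)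

  #content≡ : List Cell → ℤ → ℕ
  #content≡ F d = length (filter (λ u → content u ℤ.≟ d) F)

  #content<-suc : ∀ F d → #content< F (d + + 1) ≡ #content< F d ℕ.+ #content≡ F d
  #content<-suc F d =
    length-filter-split (λ u → content u <? d) (λ u → content u ℤ.≟ d) (λ u → content u <? (d + + 1))
      (λ {x} → <+1⇒<⊎≡ {x}) (λ p → ℤP.<-trans p (i<i+1 d)) (λ q → subst (_< d + + 1) (sym q) (i<i+1 d))
      (λ p q → ℤP.<-irrefl q p) F
    where
    <+1⇒<⊎≡ : ∀ {x} → content x < d + + 1 → content x < d ⊎ content x ≡ d
    <+1⇒<⊎≡ {x} p with ℤP.<-cmp (content x) d
    ... | tri< lt _ _ = inj₁ lt
    ... | tri≈ _ eq _ = inj₂ eq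
    ... | tri> _ _ gt = ⊥-elim (ℤP.<⇒≱ p (<⇒+1≤ gt))

  #outer< #inner< #outer≡ #inner≡ : ℤ → ℕ
  #outer< = #content< outerCells
  #inner< = #content< innerCells
  #outer≡ = #content≡ outerCells
  #inner≡ = #content≡ innerCells

  Sorted-outerContents : Sorted (outerContents L)
  Sorted-outerContents = sort-↗ (map content outerCells)

  Sorted-innerContents : Sorted (innerContents L)
  Sorted-innerContents = sort-↗ (map content innerCells)

  count<-outerContents : ∀ t → count< t (outerContents L) ≡ #outer< t
  count<-outerContents t = trans (length-filter-↭ (_<? t) (sort-↭ (map content outerCells)))
                                 (length-filter-map (_<? t) content outerCells)

  count<-innerContents : ∀ t → count< t (innerContents L) ≡ #inner< t
  count<-innerContents t = trans (length-filter-↭ (_<? t) (sort-↭ (map content innerCells)))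
                                 (length-filter-map (_<? t) content innerCells)

  ∈outerContents : ∀ {u} → OuterCorner L u → content u ∈ outerContents L
  ∈outerContents oc = ∈-resp-↭ (↭-sym (sort-↭ (map content outerCells)))
                        (∈-map⁺ content (∈-filter⁺ (outer? L) (cellsOf-complete L (proj₁ oc)) oc))

  InnerCorner⇒∈λ : ∀ {u} → InnerCorner L u → u ∈λ L
  InnerCorner⇒∈λ (me , ms , _) = s,e⇒∈λ ms me

  ∈innerContents : ∀ {u} → InnerCorner L u → content u ∈ innerContents L
  ∈innerContents ic = ∈-resp-↭ (↭-sym (sort-↭ (map content innerCells)))
                        (∈-map⁺ content (∈-filter⁺ (inner? L) (cellsOf-complete L (InnerCorner⇒∈λ ic)) ic))

  OuterCorner⇒Rim : ∀ {u} → OuterCorner L u → Rim u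
  OuterCorner⇒Rim (m , ¬e , _) = Rim-¬e m ¬e

  InnerCorner⇒Rim : ∀ {u} → InnerCorner L u → Rim u
  InnerCorner⇒Rim ic = InnerCorner⇒∈λ ic , proj₂ (proj₂ ic)

  module _ {r : Cell} (R : Rim r) where

    private
      outer-at : ∀ {y} → y ∈ filter (λ u → content u ℤ.≟ content r) outerCells → y ≡ r × OuterCorner L y
      outer-at m with ∈-filter⁻ (λ u → content u ℤ.≟ content r) {xs = outerCells} m
      ... | m₁ , c≡ with ∈-filter⁻ (outer? L) {xs = cellsOf L} m₁
      ... | _ , oc = Rim-unique (OuterCorner⇒Rim oc) R c≡ , oc

      inner-at : ∀ {y} → y ∈ filter (λ u → content u ℤ.≟ content r) innerCells → y ≡ r × InnerCorner L y
      inner-at m with ∈-filter⁻ (λ u → content u ℤ.≟ content r) {xs = innerCells} m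
      ... | m₁ , c≡ with ∈-filter⁻ (inner? L) {xs = cellsOf L} m₁
      ... | _ , ic = Rim-unique (InnerCorner⇒Rim ic) R c≡ , ic


    #outer≡-corner : ¬ (e r ∈λ L) → ¬ (s r ∈λ L) → #outer≡ (content r) ≡ 1
    #outer≡-corner ¬e ¬s = ℕP.≤-antisym
      (Unique-constant-length≤1 _ (Uniqueₚ.filter⁺ _ (Uniqueₚ.filter⁺ (outer? L) (cellsFrom-unique 1 L)))
                                  (λ m → proj₁ (outer-at m)))
      (∈-length (∈-filter⁺ (λ u → content u ℤ.≟ content r)
                  (∈-filter⁺ (outer? L) (cellsOf-complete L (proj₁ R)) (proj₁ R , ¬e , ¬s)) refl))

    #outer≡-none : e r ∈λ L ⊎ s r ∈λ L → #outer≡ (content r) ≡ 0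
    #outer≡-none e⊎s = length-empty _ λ m → case-outer (outer-at m)
      where
      case-outer : ∀ {y} → y ≡ r × OuterCorner L y → ⊥
      case-outer (refl , _ , ¬e , ¬s) = [ ¬e , ¬s ]′ e⊎s

    #inner≡-corner : e r ∈λ L → s r ∈λ L → #inner≡ (content r) ≡ 1
    #inner≡-corner me ms = ℕP.≤-antisym
      (Unique-constant-length≤1 _ (Uniqueₚ.filter⁺ _ (Uniqueₚ.filter⁺ (inner? L) (cellsFrom-unique 1 L)))
                                  (λ m → proj₁ (inner-at m)))
      (∈-length (∈-filter⁺ (λ u → content u ℤ.≟ content r)
                  (∈-filter⁺ (inner? L) (cellsOf-complete L (proj₁ R)) (me , ms , proj₂ R)) refl))

    #inner≡-none : ¬ (e r ∈λ L) ⊎ ¬ (s r ∈λ L) → #inner≡ (content r) ≡ 0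
    #inner≡-none ¬e⊎¬s = length-empty _ λ m → case-inner (inner-at m)
      where
      case-inner : ∀ {y} → y ≡ r × InnerCorner L y → ⊥
      case-inner (refl , me , ms , _) = [ (λ ¬e → ¬e me) , (λ ¬s → ¬s ms) ]′ ¬e⊎¬s

  -- Below the diagonal of a rim cell r, outer and inner corners alternate, starting with an
  -- outer corner; s r ∈ λ exactly when the last corner below is an outer one.
  Balanced : Cell → Set
  Balanced r = (#outer< (content r) ≡ #inner< (content r) × ¬ (s r ∈λ L))
             ⊎ (#outer< (content r) ≡ suc (#inner< (content r)) × s r ∈λ L)

  lower-diagonal-or-minimal : ∀ {r} → Rim r →
    (Σ Cell λ v → v ∈λ L × content v ≡ content r - + 1) ⊎ (∀ {u} → u ∈λ L → content r ≤ content u)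
  lower-diagonal-or-minimal {r} (m , _) with s r ∈λ? L | w r ∈λ? L
  ... | yes ms | _      = inj₁ (s r , ms , content-s r)
  ... | no _   | yes mw = inj₁ (w r , mw , content-w r)
  ... | no ¬s  | no ¬w  = inj₂ minimal
    where
    col≤1 : col r ≤ + 1
    col≤1 with col r ≤? + 1
    ... | yes p = p
    ... | no ¬p = ⊥-elim (¬w (w∈λ m (subst (_≤ col (w r)) (i+1-1≡i (+ 1))
                                          (ℤP.+-monoˡ-≤ (- + 1) (<⇒+1≤ (ℤP.≰⇒> ¬p))))))
    minimal : ∀ {u} → u ∈λ L → content r ≤ content u
    minimal {i′ , j′} mu with i′ ≤? row r
    ... | yes le = ℤP.+-mono-≤ (ℤP.≤-trans col≤1 (1≤col mu)) (ℤP.neg-mono-≤ le)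
    ... | no ¬le = ⊥-elim (¬s (∈λ-below mu (ℤP.≤-trans (1≤row m) (i≤i+1 (row r))) (<⇒+1≤ (ℤP.≰⇒> ¬le))
                                        (1≤col m) (ℤP.≤-trans col≤1 (1≤col mu))))

  Balanced-within : ∀ k {r} → Rim r → (∀ {u} → u ∈λ L → content r ≤ content u + + k) → Balanced r
  Balanced-within k {r} R bound with lower-diagonal-or-minimal R
  ... | inj₂ minimal =
    inj₁ (trans (length-filter-empty _ outerCells (λ m lt → ℤP.<⇒≱ lt (minimal (outer∈λ m))))
                (sym (length-filter-empty _ innerCells (λ m lt → ℤP.<⇒≱ lt (minimal (inner∈λ m))))) ,
          λ ms → ℤP.<⇒≱ (content-s<content r) (minimal ms))
    where
    outer∈λ : ∀ {y} → y ∈ outerCells → y ∈λ L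
    outer∈λ m = proj₁ (proj₂ (∈-filter⁻ (outer? L) {xs = cellsOf L} m))
    inner∈λ : ∀ {y} → y ∈ innerCells → y ∈λ L
    inner∈λ m = InnerCorner⇒∈λ (proj₂ (∈-filter⁻ (inner? L) {xs = cellsOf L} m))
  Balanced-within zero {r} R bound | inj₁ (v , mv , c≡) =
    ⊥-elim (ℤP.<⇒≱ (subst (content v <_) (trans (cong (_+ + 1) c≡) (i-1+1≡i (content r))) (i<i+1 (content v)))
                   (subst (content r ≤_) (ℤP.+-identityʳ (content v)) (bound mv)))
  Balanced-within (suc k) {r} R bound | inj₁ (v , mv , c≡) with rim-of mv
  ... | r₀ , R₀ , c₀ = step (Balanced-within k R₀ bound₀) (e r₀ ∈λ? L)
    where
    next : content r ≡ content r₀ + + 1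
    next = sym (trans (cong (_+ + 1) (trans c₀ c≡)) (i-1+1≡i (content r)))
    bound₀ : ∀ {u} → u ∈λ L → content r₀ ≤ content u + + k
    bound₀ {u} m = subst₂ _≤_ (trans (cong (_- + 1) next) (i+1-1≡i (content r₀))) (shift (content u) (+ k))
                          (ℤP.+-monoˡ-≤ (- + 1) (bound m))
      where shift : ∀ c k → (c + (+ 1 + k)) - + 1 ≡ c + k
            shift = solve-∀
    #outer<r : #outer< (content r) ≡ #outer< (content r₀) ℕ.+ #outer≡ (content r₀)
    #outer<r = trans (cong #outer< next) (#content<-suc outerCells (content r₀))
    #inner<r : #inner< (content r) ≡ #inner< (content r₀) ℕ.+ #inner≡ (content r₀)
    #inner<r = trans (cong #inner< next) (#content<-suc innerCells (content r₀))
    step : Balanced r₀ → Dec (e r₀ ∈λ L) → Balanced r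
    step (inj₁ (o≡i , ¬s₀)) (yes me)
      rewrite #outer<r | #inner<r | #outer≡-none R₀ (inj₁ me) | #inner≡-none R₀ (inj₂ ¬s₀) =
      inj₁ (cong (ℕ._+ 0) o≡i , λ ms → Rim-next-s⇒¬e R₀ R next ms me)
    step (inj₁ (o≡i , ¬s₀)) (no ¬e)
      rewrite #outer<r | #inner<r | #outer≡-corner R₀ ¬e ¬s₀ | #inner≡-none R₀ (inj₁ ¬e) =
      inj₂ (trans (ℕP.+-comm _ 1) (cong suc (trans o≡i (sym (ℕP.+-identityʳ _)))) , Rim-next-¬e⇒s R₀ R next ¬e)
    step (inj₂ (o≡i , s₀)) (yes me)
      rewrite #outer<r | #inner<r | #outer≡-none R₀ (inj₂ s₀) | #inner≡-corner R₀ me s₀ =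
      inj₁ (trans (ℕP.+-identityʳ _) (trans o≡i (ℕP.+-comm 1 _)) , λ ms → Rim-next-s⇒¬e R₀ R next ms me)
    step (inj₂ (o≡i , s₀)) (no ¬e)
      rewrite #outer<r | #inner<r | #outer≡-none R₀ (inj₂ s₀) | #inner≡-none R₀ (inj₁ ¬e) =
      inj₂ (cong (ℕ._+ 0) o≡i , Rim-next-¬e⇒s R₀ R next ¬e)

  Rim⇒Balanced : ∀ {r} → Rim r → Balanced r
  Rim⇒Balanced {r} R = Balanced-within (length L ℕ.+ ∣ content r ∣) R bound
    where
    -- every content is at least 1 - length L, and content r ≤ ∣ content r ∣
    bound : ∀ {u} → u ∈λ L → content r ≤ content u + + (length L ℕ.+ ∣ content r ∣)
    bound {i′ , j′} mu with 1≤⇒≡+suc (1≤row mu)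
    ... | a , refl = subst₂ _≤_ (ℤP.+-identityˡ _) (ℤP.+-assoc (content (+ suc a , j′)) (+ length L) (+ ∣ content r ∣))
                            (ℤP.+-mono-≤ 0≤c+len (i≤+∣i∣ (content r)))
      where
      reorder : ∀ j i l → j + (l - i) ≡ (j - i) + l
      reorder = solve-∀
      0≤c+len : + 0 ≤ content (+ suc a , j′) + + length L
      0≤c+len = subst (+ 0 ≤_) (reorder j′ (+ suc a) (+ length L))
                      (ℤP.+-mono-≤ (ℤP.≤-trans (+≤+ z≤n) (1≤col mu))
                                   (ℤP.i≤j⇒0≤j-i (+≤+ (∈λ⇒row≤length L mu))))

-- The classes O, I, A, B of a diagonal

module Classification (L : List ℕ) (isP : IsPartition L) where
  open Corners L isP public

  private
    X Y : List ℤ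
    X = outerContents L
    Y = innerContents L

  A-content B-content : ℤ → Set
  A-content c = (Σ ℤ λ o → At X 0 o × c < o)
              ⊎ (Σ ℕ λ k → Σ ℤ λ a → Σ ℤ λ b → At Y k a × At X (suc k) b × a < c × c < b)
  B-content c = (Σ ℕ λ k → Σ ℤ λ a → Σ ℤ λ b → At X k a × At Y k b × a < c × c < b)
              ⊎ (Σ ℤ λ o → At X (length Y) o × o < c)

  ¬A-content : ∀ {d} → count< (d + + 1) X ≡ suc (count< d Y) → ¬ A-content d
  ¬A-content eq (inj₁ (o , at , d<o)) =
    ℕP.n≮0 (subst (ℕ._≤ 0) eq (count<≤index Sorted-outerContents at (<⇒+1≤ d<o)))
  ¬A-content eq (inj₂ (k , a , b , atY , atX , a<d , d<b)) =
    ℕP.<-irrefl refl (ℕP.≤-trans (ℕP.≤-reflexive (sym eq))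
                       (ℕP.≤-trans (count<≤index Sorted-outerContents atX (<⇒+1≤ d<b))
                                   (index<count< Sorted-innerContents atY a<d)))

  ¬B-content : ∀ {d} → count< d X ℕ.≤ count< (d + + 1) Y → ¬ B-content d
  ¬B-content le (inj₁ (k , a , b , atX , atY , a<d , d<b)) =
    ℕP.<-irrefl refl (ℕP.≤-trans (index<count< Sorted-outerContents atX a<d)
                       (ℕP.≤-trans le (count<≤index Sorted-innerContents atY (<⇒+1≤ d<b))))
  ¬B-content {d} le (inj₂ (o , at , o<d)) =
    ℕP.<-irrefl refl (ℕP.≤-trans (index<count< Sorted-outerContents at o<d)
                       (ℕP.≤-trans le (length-filter (_<? (d + + 1)) Y)))

  module _ {r : Cell} (R : Rim r) where

    private
      d : ℤ
      d = content r
      X<d+1 : count< (d + + 1) X ≡ #outer< d ℕ.+ #outer≡ d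
      X<d+1 = trans (count<-outerContents (d + + 1)) (#content<-suc outerCells d)
      Y<d+1 : count< (d + + 1) Y ≡ #inner< d ℕ.+ #inner≡ d
      Y<d+1 = trans (count<-innerContents (d + + 1)) (#content<-suc innerCells d)

    Rim-inner : d ∈ Y → e r ∈λ L × s r ∈λ L
    Rim-inner m with ∈-map⁻ content (∈-resp-↭ (sort-↭ (map content innerCells)) m)
    ... | y , my , c≡ with ∈-filter⁻ (inner? L) {xs = cellsOf L} my
    ... | _ , ic with Rim-unique (InnerCorner⇒Rim ic) R (sym c≡)
    ... | refl = proj₁ ic , proj₁ (proj₂ ic)

    Rim-A : A-content d → e r ∈λ L × ¬ (s r ∈λ L)
    Rim-A a with e r ∈λ? L | s r ∈λ? L | Rim⇒Balanced R
    ... | yes me | no ¬s | _ = me , ¬s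
    ... | _      | yes ms | inj₁ (_ , ¬s) = ⊥-elim (¬s ms)
    ... | _      | yes ms | inj₂ (o≡i , _) = ⊥-elim (¬A-content counts a)
      where
      counts : count< (d + + 1) X ≡ suc (count< d Y)
      counts = trans X<d+1 (trans (cong₂ ℕ._+_ o≡i (#outer≡-none R (inj₂ ms)))
                                  (trans (ℕP.+-identityʳ _) (cong suc (sym (count<-innerContents d)))))
    ... | no ¬e  | no ¬s | inj₂ (_ , ms) = ⊥-elim (¬s ms)
    ... | no ¬e  | no ¬s | inj₁ (o≡i , _) = ⊥-elim (¬A-content counts a)
      where
      counts : count< (d + + 1) X ≡ suc (count< d Y)
      counts = trans X<d+1 (trans (cong₂ ℕ._+_ o≡i (#outer≡-corner R ¬e ¬s))
                                  (trans (ℕP.+-comm _ 1) (cong suc (sym (count<-innerContents d)))))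

    Rim-B : B-content d → ¬ (e r ∈λ L) × s r ∈λ L
    Rim-B b with e r ∈λ? L | s r ∈λ? L | Rim⇒Balanced R
    ... | no ¬e  | yes ms | _ = ¬e , ms
    ... | _      | no ¬s  | inj₂ (_ , ms) = ⊥-elim (¬s ms)
    ... | _      | no ¬s  | inj₁ (o≡i , _) = ⊥-elim (¬B-content counts b)
      where
      counts : count< d X ℕ.≤ count< (d + + 1) Y
      counts = ℕP.≤-trans (ℕP.≤-reflexive (trans (count<-outerContents d) o≡i))
                          (ℕP.≤-trans (ℕP.m≤m+n _ _) (ℕP.≤-reflexive (sym Y<d+1)))
    ... | yes me | yes ms | inj₁ (_ , ¬s) = ⊥-elim (¬s ms)
    ... | yes me | yes ms | inj₂ (o≡i , _) = ⊥-elim (¬B-content counts b)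
      where
      counts : count< d X ℕ.≤ count< (d + + 1) Y
      counts = ℕP.≤-reflexive (trans (count<-outerContents d)
                                (trans o≡i (trans (ℕP.+-comm 1 _)
                                  (trans (cong (#inner< d ℕ.+_) (sym (#inner≡-corner R me ms))) (sym Y<d+1)))))

    A-content-Rim : e r ∈λ L → ¬ (s r ∈λ L) → A-content d
    A-content-Rim me ¬s with Rim⇒Balanced R
    ... | inj₂ (_ , ms) = ⊥-elim (¬s ms)
    ... | inj₁ (o≡i , _) = witness (count< d Y) refl
      where
      X≡Y : count< (d + + 1) X ≡ count< d Y
      X≡Y = trans X<d+1 (trans (cong₂ ℕ._+_ o≡i (#outer≡-none R (inj₁ me)))
                          (trans (ℕP.+-identityʳ _) (sym (count<-innerContents d))))
      -- the end of the row of r is an outer corner beyond diagonal d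
      o : Cell
      o = (row r , + rowLen L (row r))
      o-corner : OuterCorner L o
      o-corner = (ℤP.≤-trans (ℤP.≤-trans (1≤col (proj₁ R)) (i≤i+1 (col r))) (proj₂ me) , ℤP.≤-refl)
               , (λ p → ℤP.<-irrefl refl (+1≤⇒< (proj₂ p)))
               , (λ p → ¬s (∈λ-below p (1≤row p) ℤP.≤-refl (1≤col (proj₁ R))
                                     (ℤP.≤-trans (i≤i+1 (col r)) (proj₂ me))))
      d+1≤o : d + + 1 ≤ content o
      d+1≤o = subst (_≤ content o) (content-e r) (ℤP.+-monoˡ-≤ (- row r) (proj₂ me))
      X-not-all-below : count< (d + + 1) X ℕ.< length X
      X-not-all-below = filter-notAll (_<? (d + + 1)) X (lose (∈outerContents o-corner) (ℤP.≤⇒≯ d+1≤o))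
      witness : ∀ k → count< d Y ≡ k → A-content d
      witness zero eq with At-≥-from-count< {k = 0} Sorted-outerContents (ℕP.≤-<-trans z≤n X-not-all-below)
                                             (ℕP.≤-reflexive (trans X≡Y eq))
      ... | o′ , at , le = inj₁ (o′ , at , +1≤⇒< le)
      witness (suc k) eq
        with At-<-from-count< {k = k} Sorted-innerContents (ℕP.≤-reflexive (sym eq))
           | At-≥-from-count< {k = suc k} Sorted-outerContents (subst (ℕ._< length X) (trans X≡Y eq) X-not-all-below)
                              (ℕP.≤-reflexive (trans X≡Y eq))
      ... | a , atY , a<d | b , atX , le = inj₂ (k , a , b , atY , atX , a<d , +1≤⇒< le)

    B-content-Rim : ¬ (e r ∈λ L) → s r ∈λ L → B-content d
    B-content-Rim ¬e ms with Rim⇒Balanced R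
    ... | inj₁ (_ , ¬s) = ⊥-elim (¬s ms)
    ... | inj₂ (o≡i , _) = witness (count< d Y ℕ.<? length Y)
      where
      X≡ : count< d X ≡ suc (count< d Y)
      X≡ = trans (count<-outerContents d) (trans o≡i (cong suc (sym (count<-innerContents d))))
      Y≡ : count< (d + + 1) Y ≡ count< d Y
      Y≡ = trans Y<d+1 (trans (cong (#inner< d ℕ.+_) (#inner≡-none R (inj₁ ¬e)))
                         (trans (ℕP.+-identityʳ _) (sym (count<-innerContents d))))
      witness : Dec (count< d Y ℕ.< length Y) → B-content d
      witness (yes lt) with At-≥-from-count< Sorted-innerContents lt (ℕP.≤-reflexive Y≡)
                          | At-<-from-count< Sorted-outerContents (ℕP.≤-reflexive (sym X≡))
      ... | b , atY , le | a , atX , a<d = inj₁ (count< d Y , a , b , atX , atY , a<d , +1≤⇒< le)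
      witness (no ¬lt) with At-<-from-count< {k = length Y} Sorted-outerContents
                              (ℕP.≤-trans (s≤s (ℕP.≮⇒≥ ¬lt)) (ℕP.≤-reflexive (sym X≡)))
      ... | o , at , o<d = inj₂ (o , at , o<d)

  module _ {u r : Cell} (m : u ∈λ L) (R : Rim r) (c≡ : content r ≡ content u) where

    inO⇐ : ¬ (e r ∈λ L) → ¬ (s r ∈λ L) → inO L u
    inO⇐ ¬e ¬s = m , subst (_∈ X) c≡ (∈outerContents (proj₁ R , ¬e , ¬s))

    inI⇒ : inI L u → e r ∈λ L × s r ∈λ L
    inI⇒ i = Rim-inner R (subst (_∈ Y) (sym c≡) (proj₂ i))

    inI⇐ : e r ∈λ L → s r ∈λ L → inI L u
    inI⇐ me ms = m , subst (_∈ Y) c≡ (∈innerContents (me , ms , proj₂ R))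

    inA⇒ : inA L u → e r ∈λ L × ¬ (s r ∈λ L)
    inA⇒ a = Rim-A R (subst A-content (sym c≡) (proj₂ a))

    inA⇐ : e r ∈λ L → ¬ (s r ∈λ L) → inA L u
    inA⇐ me ¬s = m , subst A-content c≡ (A-content-Rim R me ¬s)

    inB⇒ : inB L u → ¬ (e r ∈λ L) × s r ∈λ L
    inB⇒ b = Rim-B R (subst B-content (sym c≡) (proj₂ b))

    inB⇐ : ¬ (e r ∈λ L) → s r ∈λ L → inB L u
    inB⇐ ¬e ms = m , subst B-content c≡ (B-content-Rim R ¬e ms)

    inI⊎inA⇒e : inI L u ⊎ inA L u → e r ∈λ L
    inI⊎inA⇒e = [ (λ i → proj₁ (inI⇒ i)) , (λ a → proj₁ (inA⇒ a)) ]′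

    inB⊎inI⇒s : inB L u ⊎ inI L u → s r ∈λ L
    inB⊎inI⇒s = [ (λ b → proj₂ (inB⇒ b)) , (λ i → proj₂ (inI⇒ i)) ]′

≤∞-<∞-trans : ∀ {x y z} → x ≤∞ y → y <∞ z → x <∞ z
≤∞-<∞-trans (fin≤fin p) (fin<fin q) = fin<fin (ℕP.≤-<-trans p q)
≤∞-<∞-trans (fin≤fin p) fin<∞       = fin<∞

<∞-fin⇒0< : ∀ {x b} → x <∞ fin b → 0 ℕ.< b
<∞-fin⇒0< (fin<fin p) = ℕP.≤-<-trans z≤n p

fin-injective : ∀ {a b} → fin a ≡ fin b → a ≡ b
fin-injective refl = refl

fin≢∞ : ∀ {a} → fin a ≢ ∞
fin≢∞ ()

_<∞?_ : ∀ x y → Dec (x <∞ y)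
fin a <∞? fin b with a ℕ.<? b
... | yes p = yes (fin<fin p)
... | no ¬p = no λ { (fin<fin q) → ¬p q }
fin a <∞? ∞ = yes fin<∞
∞     <∞? y = no λ ()

module Values (L : List ℕ) (f : Cell → ℕ) where

  ev-∈λ : ∀ {u} → u ∈λ L → ev L f u ≡ fin (f u)
  ev-∈λ {i , j} m with i ≤? + 0 | j ≤? + 0
  ... | yes p | _     = ⊥-elim (ℤP.<⇒≱ (+1≤⇒< (∈λ⇒1≤row L m)) p)
  ... | no _  | yes q = ⊥-elim (ℤP.<⇒≱ (+1≤⇒< (proj₁ m)) q)
  ... | no _  | no _ with (i , j) ∈λ? L
  ...   | yes _ = refl
  ...   | no ¬m = ⊥-elim (¬m m)

  ev-∉λ : ∀ {u} → + 1 ≤ row u → + 1 ≤ col u → ¬ (u ∈λ L) → ev L f u ≡ ∞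
  ev-∉λ {i , j} 1≤i 1≤j ¬m with i ≤? + 0 | j ≤? + 0
  ... | yes p | _     = ⊥-elim (ℤP.<⇒≱ (+1≤⇒< 1≤i) p)
  ... | no _  | yes q = ⊥-elim (ℤP.<⇒≱ (+1≤⇒< 1≤j) q)
  ... | no _  | no _ with (i , j) ∈λ? L
  ...   | yes m = ⊥-elim (¬m m)
  ...   | no _  = refl

  ev-col≤0 : ∀ {u} → col u ≤ + 0 → ev L f u ≡ fin 0
  ev-col≤0 {i , j} c with i ≤? + 0 | j ≤? + 0
  ... | yes _ | _     = refl
  ... | no _  | yes _ = refl
  ... | no _  | no ¬c = ⊥-elim (¬c c)

  ev-row≤0 : ∀ {u} → row u ≤ + 0 → ev L f u ≡ fin 0
  ev-row≤0 {i , j} r with i ≤? + 0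
  ... | yes _ = refl
  ... | no ¬r = ⊥-elim (¬r r)

module Filling (L : List ℕ) (isP : IsPartition L) (π : Cell → ℕ) (rpp : IsRPP L π) where
  open Classification L isP public
  open Values L π public

  π-mono-e : ∀ {u} → u ∈λ L → e u ∈λ L → π u ℕ.≤ π (e u)
  π-mono-e {u} m me with proj₁ (rpp u m)
  ... | le rewrite ev-∈λ me with le
  ...   | fin≤fin p = p

  π-mono-s : ∀ {u} → u ∈λ L → s u ∈λ L → π u ℕ.≤ π (s u)
  π-mono-s {u} m ms with proj₂ (rpp u m)
  ... | le rewrite ev-∈λ ms with le
  ...   | fin≤fin p = p

  π-w≤π : ∀ {u} → u ∈λ L → w u ∈λ L → π (w u) ℕ.≤ π u
  π-w≤π {u} m mw = subst (λ z → π (w u) ℕ.≤ π z) (e-w u) (π-mono-e mw (subst (_∈λ L) (sym (e-w u)) m))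

  π-n≤π : ∀ {u} → u ∈λ L → n u ∈λ L → π (n u) ℕ.≤ π u
  π-n≤π {u} m mn = subst (λ z → π (n u) ℕ.≤ π z) (s-n u) (π-mono-s mn (subst (_∈λ L) (sym (s-n u)) m))

  ev-n≤ : ∀ {u} → u ∈λ L → ev L π (n u) ≤∞ fin (π u)
  ev-n≤ {u} m with + 1 ≤? row (n u)
  ... | yes 1≤i = subst (_≤∞ fin (π u)) (sym (ev-∈λ (n∈λ m 1≤i))) (fin≤fin (π-n≤π m (n∈λ m 1≤i)))
  ... | no 1≰i = subst (_≤∞ fin (π u)) (sym (ev-row≤0 (¬1≤⇒≤0 1≰i))) (fin≤fin z≤n)

  ev-nw≤ev-w : ∀ {u} → u ∈λ L → ev L π (n (w u)) ≤∞ ev L π (w u)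
  ev-nw≤ev-w {u} m with + 1 ≤? col (w u)
  ... | yes 1≤j = subst (ev L π (n (w u)) ≤∞_) (sym (ev-∈λ (w∈λ m 1≤j))) (ev-n≤ (w∈λ m 1≤j))
  ... | no 1≰j rewrite ev-col≤0 {w u} (¬1≤⇒≤0 1≰j) | ev-col≤0 {n (w u)} (¬1≤⇒≤0 1≰j) = fin≤fin z≤n

  π-≡-s : ∀ {u} → u ∈λ L → ev L π u ≡ ev L π (s u) → s u ∈λ L × π u ≡ π (s u)
  π-≡-s {u} m eq with s u ∈λ? L
  ... | yes ms = ms , fin-injective (trans (sym (ev-∈λ m)) (trans eq (ev-∈λ ms)))
  ... | no ¬ms = ⊥-elim (fin≢∞ (trans (sym (ev-∈λ m))
                                  (trans eq (ev-∉λ (ℤP.≤-trans (1≤row m) (i≤i+1 (row u))) (1≤col m) ¬ms))))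

  north-<⊎≡ : ∀ {u} → u ∈λ L → 0 ℕ.< π u → ev L π (n u) <∞ ev L π u ⊎ (n u ∈λ L × π (n u) ≡ π u)
  north-<⊎≡ {u} m 0<π rewrite ev-∈λ m with + 1 ≤? row (n u)
  ... | no 1≰i rewrite ev-row≤0 {n u} (¬1≤⇒≤0 1≰i) = inj₁ (fin<fin 0<π)
  ... | yes 1≤i with π (n u) ℕ.<? π u
  ...   | yes lt = inj₁ (subst (_<∞ fin (π u)) (sym (ev-∈λ (n∈λ m 1≤i))) (fin<fin lt))
  ...   | no ¬lt = inj₂ (n∈λ m 1≤i , ℕP.≤-antisym (π-n≤π m (n∈λ m 1≤i)) (ℕP.≮⇒≥ ¬lt))

-- No candidate before a

module NoCandidate (L : List ℕ) (isP : IsPartition L) (π : Cell → ℕ) (rpp : IsRPP L π)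
                   (a : Cell) (none : ∀ {u} → Cand L π u → u ◁ a → ⊥) where
  open Filling L isP π rpp public

  ◁⇒content≥ : ∀ {u} → u ◁ a → content a ≤ content u
  ◁⇒content≥ (inj₁ lt , _)       = ℤP.<⇒≤ lt
  ◁⇒content≥ (inj₂ (eq , _) , _) = ℤP.≤-reflexive (sym eq)

  content>⇒◁ : ∀ {v} → content a < content v → v ◁ a
  content>⇒◁ lt = inj₁ lt , λ eq → ℤP.<-irrefl (cong content (sym eq)) lt

  row>⇒◁ : ∀ {v} → content v ≡ content a → row a < row v → v ◁ a
  row>⇒◁ eq lt = inj₂ (eq , ℤP.<⇒≤ lt) , λ eq′ → ℤP.<-irrefl (cong row (sym eq′)) lt

  -- On a diagonal whose rim cell r has s r ∉ λ (the diagonals of O ∪ A), a west ascent would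
  -- propagate north along equal values until it produced a candidate.
  no-west-ascent-row : ∀ k {u r} → row u ≡ + suc k → u ∈λ L → Rim r → content r ≡ content u →
                       ¬ (s r ∈λ L) → u ◁ a → ¬ (ev L π (w u) <∞ ev L π u)
  no-west-ascent-row k {u} {r} rk m R c≡ ¬s u◁a lt with e r ∈λ? L
  ... | no ¬e = none (inj₁ (inO⇐ m R c≡ ¬e ¬s , lt)) u◁a
  ... | yes me with north-<⊎≡ m (<∞-fin⇒0< (subst (ev L π (w u) <∞_) (ev-∈λ m) lt))
  ...   | inj₁ n< = none (inj₂ (inA⇐ m R c≡ me ¬s , lt , n<)) u◁a
  ...   | inj₂ (mn , π≡) with k
  ...     | zero = ℤP.<-irrefl refl (ℤP.<-≤-trans (subst (_< + 1) (sym (cong (_- + 1) rk)) (+<+ (s≤s z≤n)))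
                                                (1≤row mn))
  ...     | suc k′ with rim-of mn
  ...       | r′ , R′ , c′ = no-west-ascent-row k′ (cong (_- + 1) rk) mn R′ c′ ¬s′ n◁a lt′
    where
    ¬s′ : ¬ (s r′ ∈λ L)
    ¬s′ ms′ = Rim-next-s⇒¬e R R′ (trans c′ (trans (content-n u) (cong (_+ + 1) (sym c≡)))) ms′ me
    n◁a : n u ◁ a
    n◁a = content>⇒◁ (ℤP.≤-<-trans (◁⇒content≥ u◁a)
                        (subst (content u <_) (sym (content-n u)) (i<i+1 (content u))))
    lt′ : ev L π (w (n u)) <∞ ev L π (n u)
    lt′ = subst (ev L π (w (n u)) <∞_) (trans (ev-∈λ m) (trans (cong fin (sym π≡)) (sym (ev-∈λ mn))))
                (≤∞-<∞-trans (ev-nw≤ev-w m) lt)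

  no-west-ascent : ∀ {u r} → u ∈λ L → Rim r → content r ≡ content u → ¬ (s r ∈λ L) →
                   u ◁ a → ¬ (ev L π (w u) <∞ ev L π u)
  no-west-ascent m with 1≤⇒≡+suc (1≤row m)
  ... | k , rk = no-west-ascent-row k rk m

  south-strict : ∀ {p r} → p ∈λ L → Rim r → content r ≡ content p → ¬ (s r ∈λ L) →
                 (e (s p) ∈λ L → π p ℕ.< π (e (s p))) → e (s p) ◁ a → s p ∈λ L → π p ℕ.< π (s p)
  south-strict {p} {r} m R c≡ ¬s below-east es◁a ms with π p ℕ.<? π (s p)
  ... | yes lt = lt
  ... | no ¬lt with e (s p) ∈λ? L
  ...   | no ¬es = ⊥-elim (¬s (Rim-next-¬e⇒s (Rim-¬e ms ¬es) R c≡′ ¬es))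
    where
    c≡′ : content r ≡ content (s p) + + 1
    c≡′ = trans c≡ (sym (content-s+1 p))
  ...   | yes mes = ⊥-elim (no-west-ascent mes R (trans c≡ (sym (content-es p))) ¬s es◁a west-ascent)
    where
    π≡ : π p ≡ π (s p)
    π≡ = ℕP.≤-antisym (π-mono-s m ms) (ℕP.≮⇒≥ ¬lt)
    west-ascent : ev L π (w (e (s p))) <∞ ev L π (e (s p))
    west-ascent = subst (λ z → ev L π z <∞ ev L π (e (s p))) (sym (w-e (s p)))
                    (subst₂ _<∞_ (sym (ev-∈λ ms)) (sym (ev-∈λ mes))
                      (fin<fin (subst (ℕ._< π (e (s p))) π≡ (below-east mes))))

  first-column-◁ : ∀ {x} → col a ≤ + 0 → col x ≡ + 1 → content a ≤ content x → x ◁ a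
  first-column-◁ {x} ca≤0 cx c≤ with ℤP.<-cmp (content a) (content x)
  ... | tri< lt _ _ = content>⇒◁ lt
  ... | tri> _ _ gt = ⊥-elim (ℤP.<⇒≱ gt c≤)
  ... | tri≈ _ eq _ = row>⇒◁ (sym eq) row-a<row-x
    where
    row-a<row-x : row a < row x
    row-a<row-x = subst₂ _<_ (sym (row≡col-content a))
                              (trans (cong (_- content a) (sym cx)) (trans (cong (λ c → col x - c) eq) (sym (row≡col-content x))))
                              (ℤP.+-monoˡ-< (- content a) (ℤP.≤-<-trans ca≤0 (+<+ (s≤s z≤n))))

  -- α₀ stands for the head of the rim hook, which lies on the diagonal of a.
  module _ {α₀} (mα : α₀ ∈λ L) (cα : content α₀ ≡ content a) (¬sα : ¬ (s α₀ ∈λ L)) where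

    first-column-∈λ : ∀ {x} → col x ≡ + 1 → + 1 ≤ row x → content a ≤ content x → x ∈λ L
    first-column-∈λ {x} cx 1≤row c≤ =
      ∈λ-below mα 1≤row row≤ (ℤP.≤-reflexive (sym cx)) (subst (_≤ col α₀) (sym cx) (1≤col mα))
      where
      row≤ : row x ≤ row α₀
      row≤ = subst₂ _≤_ (sym (trans (row≡col-content x) (cong (_- content x) cx)))
                        (trans (cong (λ c → col α₀ - c) (sym cα)) (sym (row≡col-content α₀)))
                        (ℤP.+-mono-≤ (1≤col mα) (ℤP.neg-mono-≤ c≤))

    first-column-vanishes : col a ≤ + 0 → ∀ {x} → x ∈λ L → col x ≡ + 1 → content a ≤ content x → ¬ (0 ℕ.< π x)
    first-column-vanishes ca≤0 {x} mx cx c≤ =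
      go ∣ content x - content a ∣ mx cx
         (sym (trans (cong (λ k → content a + k) (ℤP.0≤i⇒+∣i∣≡i (ℤP.i≤j⇒0≤j-i c≤)))
                     (cancel (content a) (content x))))
      where
      cancel : ∀ c d → c + (d - c) ≡ d
      cancel = solve-∀
      go : ∀ k {x} → x ∈λ L → col x ≡ + 1 → content x ≡ content a + + k → ¬ (0 ℕ.< π x)
      go k {x} mx cx ck 0<π with rim-of mx
      ... | r , R , cr with s r ∈λ? L
      ...   | no ¬s = no-west-ascent mx R cr ¬s (first-column-◁ ca≤0 cx (subst (content a ≤_) (sym ck) (ℤP.i≤i+j _ _)))
                        (subst₂ _<∞_ (sym (ev-col≤0 {w x} (ℤP.≤-reflexive (cong (_- + 1) cx))))
                                     (sym (ev-∈λ mx)) (fin<fin 0<π))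
      go zero {x} mx cx ck 0<π | r , R , cr | yes ms
        with Rim-unique R (Rim-¬s mα ¬sα) (trans cr (trans ck (trans (ℤP.+-identityʳ _) (sym cα))))
      ... | refl = ¬sα ms
      go (suc k) {x} mx cx ck 0<π | r , R , cr | yes ms = go k msx cx content-sx (ℕP.<-≤-trans 0<π (π-mono-s mx msx))
        where
        content-sx : content (s x) ≡ content a + + k
        content-sx = trans (content-s x)
                           (trans (cong (_- + 1) (trans ck (cong (λ k → content a + k) (ℤP.pos-+ 1 k))))
                                  (shift (content a) (+ k)))
          where shift : ∀ c k → (c + (+ 1 + k)) - + 1 ≡ c + k
                shift = solve-∀
        msx : s x ∈λ L
        msx = first-column-∈λ cx (ℤP.≤-trans (1≤row mx) (i≤i+1 (row x)))
                              (subst (content a ≤_) (sym content-sx) (ℤP.i≤i+j _ _))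

-- The walk P(h, π) as a north-east path

lastOf-snoc : ∀ v xs u → lastOf v (xs ++ [ u ]) ≡ u
lastOf-snoc v []       u = refl
lastOf-snoc v (x ∷ xs) u = lastOf-snoc x xs u

lastOf-∈ : ∀ v xs → lastOf v xs ∈ v ∷ xs
lastOf-∈ v []       = here refl
lastOf-∈ v (x ∷ xs) = there (lastOf-∈ x xs)

Linked-snoc : ∀ {R : Cell → Cell → Set} v xs u → Linked R (v ∷ xs) → R (lastOf v xs) u → Linked R (v ∷ xs ++ [ u ])
Linked-snoc v []       u _        r = r ∷ [-]
Linked-snoc v (x ∷ xs) u (r′ ∷ l) r = r′ ∷ Linked-snoc x xs u l r

content-lastOf : ∀ u us → Linked NEStep (u ∷ us) → content (lastOf u us) ≡ content u + + length us
content-lastOf u []       _          = sym (ℤP.+-identityʳ (content u))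
content-lastOf u (v ∷ vs) (st ∷ lk) =
  trans (content-lastOf v vs lk)
        (trans (cong (_+ + length vs) (step st))
               (trans (ℤP.+-assoc (content u) (+ 1) (+ length vs)) (cong (λ k → content u + k) (sym (ℤP.pos-+ 1 (length vs))))))
  where
  step : ∀ {u v} → NEStep u v → content v ≡ content u + + 1
  step {u} (inj₁ refl) = content-n u
  step {u} (inj₂ refl) = content-e u

∈-snoc-below : ∀ {xs q u} → content q < content u → (∀ {y} → y ∈ xs → y ≡ q ⊎ content y < content q) →
               ∀ {y} → y ∈ xs ++ [ u ] → y ≡ u ⊎ content y < content u
∈-snoc-below {xs} q<u below m with ∈-++⁻ xs m
... | inj₂ (here refl) = inj₁ refl
... | inj₁ m′ with below m′
...   | inj₁ refl = inj₂ q<u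
...   | inj₂ lt   = inj₂ (ℤP.<-trans lt q<u)

snoc : Path → Cell → Path
snoc (v , xs) u = v , xs ++ [ u ]

module _ {L : List ℕ} {π : Cell → ℕ} where

  walkPath : ∀ {j u v} → SWWalk L π j u v → Path
  walkPath {u = u} stop        = u , []
  walkPath {u = u} (south _ W) = snoc (walkPath W) u
  walkPath {u = u} (west _ W)  = snoc (walkPath W) u

  walkCells : ∀ {j u v} → SWWalk L π j u v → List Cell
  walkCells W = cells (walkPath W)

  ω-walkPath : ∀ {j u v} (W : SWWalk L π j u v) → ω (walkPath W) ≡ u
  ω-walkPath stop                = refl
  ω-walkPath {u = u} (south _ W) = lastOf-snoc (proj₁ (walkPath W)) (proj₂ (walkPath W)) u
  ω-walkPath {u = u} (west _ W)  = lastOf-snoc (proj₁ (walkPath W)) (proj₂ (walkPath W)) u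

  len-walkPath : ∀ {j u v} (W : SWWalk L π j u v) → len (walkPath W) ≡ j
  len-walkPath stop        = refl
  len-walkPath (south _ W) = trans (length-++ (proj₂ (walkPath W))) (trans (ℕP.+-comm _ 1) (cong suc (len-walkPath W)))
  len-walkPath (west _ W)  = trans (length-++ (proj₂ (walkPath W))) (trans (ℕP.+-comm _ 1) (cong suc (len-walkPath W)))

  start∈walkCells : ∀ {j u v} (W : SWWalk L π j u v) → u ∈ walkCells W
  start∈walkCells W = subst (_∈ walkCells W) (ω-walkPath W) (lastOf-∈ (proj₁ (walkPath W)) (proj₂ (walkPath W)))

  walkPath-NE : ∀ {j u v} (W : SWWalk L π j u v) → Linked NEStep (walkCells W)
  walkPath-NE stop = [-]
  walkPath-NE {u = u} (south _ W) =
    Linked-snoc (proj₁ (walkPath W)) (proj₂ (walkPath W)) u (walkPath-NE W)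
      (subst (λ z → NEStep z u) (sym (ω-walkPath W)) (inj₁ (sym (n-s u))))
  walkPath-NE {u = u} (west _ W) =
    Linked-snoc (proj₁ (walkPath W)) (proj₂ (walkPath W)) u (walkPath-NE W)
      (subst (λ z → NEStep z u) (sym (ω-walkPath W)) (inj₂ (sym (e-w u))))

  col-walk-end : ∀ {j u v} → SWWalk L π j u v → col v ≤ col u
  col-walk-end stop                = ℤP.≤-refl
  col-walk-end (south _ W)         = col-walk-end W
  col-walk-end {u = u} (west _ W)  = ℤP.≤-trans (col-walk-end W) (i-1≤i (col u))

  content-walk-end : ∀ {j u v} → SWWalk L π j u v → content v ≡ content u - + j
  content-walk-end {u = u} stop = sym (ℤP.+-identityʳ (content u))
  content-walk-end {suc j} {u} (south _ W) =
    trans (content-walk-end W) (trans (cong (_- + j) (content-s u)) (shift (content u) (+ j)))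
    where shift : ∀ c k → (c - + 1) - k ≡ c - (+ 1 + k)
          shift = solve-∀
  content-walk-end {suc j} {u} (west _ W) =
    trans (content-walk-end W) (trans (cong (_- + j) (content-w u)) (shift (content u) (+ j)))
    where shift : ∀ c k → (c - + 1) - k ≡ c - (+ 1 + k)
          shift = solve-∀

  walkCells-below : ∀ {j u v} (W : SWWalk L π j u v) → ∀ {y} → y ∈ walkCells W → y ≡ u ⊎ content y < content u
  walkCells-below stop              (here refl) = inj₁ refl
  walkCells-below {u = u} (south _ W) = ∈-snoc-below (content-s<content u) (walkCells-below W)
  walkCells-below {u = u} (west _ W)  = ∈-snoc-below (content-w<content u) (walkCells-below W)

module _ (L : List ℕ) (π : Cell → ℕ) (P : Path) where
  open Values L (addPath π P)

  addPath-≤∞ : ∀ {u v} → u ∈λ L → + 1 ≤ row v → + 1 ≤ col v → (v ∈λ L → π u ℕ.≤ π v) →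
               (u ∈ cells P → v ∈λ L → v ∉ cells P → π u ℕ.< π v) →
               fin (addPath π P u) ≤∞ ev L (addPath π P) v
  addPath-≤∞ {u} {v} mu 1≤i 1≤j ≤v <v with v ∈λ? L
  ... | no ¬mv rewrite ev-∉λ 1≤i 1≤j ¬mv = _ ≤∞∞
  ... | yes mv rewrite ev-∈λ mv with u ∈ᶜ? cells P | v ∈ᶜ? cells P
  ...   | yes uP | yes vP = fin≤fin (s≤s (≤v mv))
  ...   | yes uP | no  v∉ = fin≤fin (<v uP mv v∉)
  ...   | no  u∉ | yes vP = fin≤fin (ℕP.m≤n⇒m≤1+n (≤v mv))
  ...   | no  u∉ | no  v∉ = fin≤fin (≤v mv)

module Fitting (L : List ℕ) (isP : IsPartition L) (π : Cell → ℕ) (rpp : IsRPP L π)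
               (a : Cell) (none : ∀ {u} → Cand L π u → u ◁ a → ⊥)
               {α₀ : Cell} (mα : α₀ ∈λ L) (cα : content α₀ ≡ content a) (¬sα : ¬ (s α₀ ∈λ L))
               (P : Path) where
  open NoCandidate L isP π rpp a none public

  C : List Cell
  C = cells P

  record Fits (y : Cell) : Set where
    field
      fits-∈λ    : y ∈λ L
      fits-e<    : e y ∈λ L → e y ∉ C → π y ℕ.< π (e y)
      fits-s<    : s y ∈λ L → s y ∉ C → π y ℕ.< π (s y)
      fits-e≡    : inI L y ⊎ inA L y → e y ∈ C × π y ≡ π (e y)
      fits-s≡    : s y ∈ C → π y ≡ π (s y)

  -- W is the rest of the walk, from the current cell p to a.
  record Invariant {j p} (W : SWWalk L π j p a) : Set where
    field
      inv-∈λ      : p ∈λ L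
      inv-es<     : e (s p) ∈λ L → π p ℕ.< π (e (s p))
      inv-e<      : e p ∈λ L → e p ∉ C → π p ℕ.< π (e p)
      inv-e≡      : inI L p ⊎ inA L p → e p ∈ C × π p ≡ π (e p)
      inv-⊆       : ∀ {y} → y ∈ walkCells W → y ∈ C
      inv-rest>   : ∀ {y} → y ∈ C → y ∉ walkCells W → content p < content y

  open Fits
  open Invariant

  rest>-snoc : ∀ {xs p q} → content q < content p → (∀ {y} → y ∈ C → y ∉ xs ++ [ p ] → content p < content y) →
               ∀ {y} → y ∈ C → y ∉ xs → content q < content y
  rest>-snoc {xs} {p} q<p rest> {y} yC y∉ with y ≟ᶜ p
  ... | yes refl = q<p
  ... | no y≢p   = ℤP.<-trans q<p (rest> yC λ m → [ y∉ , (λ { (here eq) → y≢p eq }) ]′ (∈-++⁻ xs m))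

  stop-fits : Invariant (stop {u = a}) → Fits a
  stop-fits inv = record
    { fits-∈λ = inv-∈λ inv
    ; fits-e< = inv-e< inv
    ; fits-s< = λ ms _ → south-strict (inv-∈λ inv) (Rim-¬s mα ¬sα) cα ¬sα (inv-es< inv)
                                        (row>⇒◁ (content-es a) (i<i+1 (row a))) ms
    ; fits-e≡ = inv-e≡ inv
    ; fits-s≡ = λ m → ⊥-elim (ℤP.<-asym (inv-rest> inv m s∉) (content-s<content a))
    }
    where
    s∉ : s a ∉ a ∷ []
    s∉ (here eq) = ℤP.<-irrefl (cong content eq) (content-s<content a)

  south-step : ∀ {j p} (dk : DownOK L π p) (W : SWWalk L π j (s p) a) →
               Invariant (south dk W) → Fits p × Invariant W
  south-step {p = p} dk W inv with rim-of (inv-∈λ inv) | π-≡-s (inv-∈λ inv) (proj₂ dk)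
  ... | r , R , cr | ms , π≡ with rim-of ms
  ... | r′ , R′ , cr′ = fits , inv′
    where
    m = inv-∈λ inv
    next : content r ≡ content r′ + + 1
    next = trans cr (trans (sym (content-s+1 p)) (cong (_+ + 1) (sym cr′)))
    -- p lies on a diagonal of B ∪ I, so s p does not lie on one of I ∪ A
    s-r : s r ∈λ L
    s-r = inB⊎inI⇒s m R cr (proj₁ dk)
    ¬e-r′ : ¬ (e r′ ∈λ L)
    ¬e-r′ = Rim-next-s⇒¬e R′ R next s-r
    fits : Fits p
    fits = record
      { fits-∈λ = m
      ; fits-e< = inv-e< inv
      ; fits-s< = λ _ s∉C → ⊥-elim (s∉C (inv-⊆ inv (∈-++⁺ˡ (start∈walkCells W))))
      ; fits-e≡ = inv-e≡ inv
      ; fits-s≡ = λ _ → π≡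
      }
    inv′ : Invariant W
    inv′ = record
      { inv-∈λ    = ms
      ; inv-es<   = λ mess → subst (ℕ._< π (e (s (s p)))) π≡
                               (ℕP.<-≤-trans (inv-es< inv (es⇒e ms mess)) (π-mono-s (es⇒e ms mess) mess))
      ; inv-e<    = λ mes _ → subst (ℕ._< π (e (s p))) π≡ (inv-es< inv mes)
      ; inv-e≡    = λ i⊎a → ⊥-elim (¬e-r′ (inI⊎inA⇒e ms R′ cr′ i⊎a))
      ; inv-⊆     = λ m′ → inv-⊆ inv (∈-++⁺ˡ m′)
      ; inv-rest> = rest>-snoc {q = s p} (content-s<content p) (inv-rest> inv)
      }

  west-s< : ∀ {p} → ¬ DownOK L π p → p ∈λ L → (e (s p) ∈λ L → π p ℕ.< π (e (s p))) →
            content a < content p → s p ∈λ L → π p ℕ.< π (s p)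
  west-s< {p} ndk m es< a<p ms with rim-of m | π p ℕ.<? π (s p)
  ... | _ , _ , _  | yes lt = lt
  ... | r , R , cr | no ¬lt = south-strict m R cr ¬s es< (content>⇒◁ (subst (content a <_) (sym (content-es p)) a<p)) ms
    where
    π≡ : π p ≡ π (s p)
    π≡ = ℕP.≤-antisym (π-mono-s m ms) (ℕP.≮⇒≥ ¬lt)
    -- otherwise p would lie on a diagonal of B ∪ I and the walk would have moved south
    ¬s : ¬ (s r ∈λ L)
    ¬s ms-r = ndk (B⊎I , trans (ev-∈λ m) (trans (cong fin π≡) (sym (ev-∈λ ms))))
      where
      B⊎I : inB L p ⊎ inI L p
      B⊎I with e r ∈λ? L
      ... | yes me = inj₂ (inI⇐ m R cr me ms-r)
      ... | no ¬e  = inj₁ (inB⇐ m R cr ¬e ms-r)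

  west-∈λ : ∀ {j p} → SWWalk L π j (w p) a → p ∈λ L → content a < content p →
            (s p ∈λ L → π p ℕ.< π (s p)) → w p ∈λ L
  west-∈λ {p = p} W m a<p s< with + 1 ≤? col (w p)
  ... | yes 1≤j = w∈λ m 1≤j
  ... | no 1≰j = ⊥-elim (first-column-vanishes mα cα ¬sα (ℤP.≤-trans (col-walk-end W) col-wp≤0) msp cp a≤sp
                                              (ℕP.≤-<-trans z≤n (s< msp)))
    where
    col-wp≤0 : col (w p) ≤ + 0
    col-wp≤0 = ¬1≤⇒≤0 1≰j
    cp : col (s p) ≡ + 1
    cp = ℤP.≤-antisym (subst (_≤ + 1) (i-1+1≡i (col p)) (ℤP.+-monoˡ-≤ (+ 1) col-wp≤0)) (1≤col m)
    a≤sp : content a ≤ content (s p)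
    a≤sp = subst₂ _≤_ (i+1-1≡i (content a)) (sym (content-s p)) (ℤP.+-monoˡ-≤ (- + 1) (<⇒+1≤ a<p))
    msp : s p ∈λ L
    msp = first-column-∈λ mα cα ¬sα cp (ℤP.≤-trans (1≤row m) (i≤i+1 (row p))) a≤sp

  west-e≡ : ∀ {p} → p ∈λ L → w p ∈λ L → content a < content p → p ∈ C →
            inI L (w p) ⊎ inA L (w p) → e (w p) ∈ C × π (w p) ≡ π (e (w p))
  west-e≡ {p} m mw a<p pC i⊎a with rim-of m | rim-of mw
  ... | r , R , cr | r′ , R′ , cr′ = subst (_∈ C) (sym (e-w p)) pC , subst (λ z → π (w p) ≡ π z) (sym (e-w p)) π≡
    where
    next : content r ≡ content r′ + + 1
    next = trans cr (trans (sym (content-w+1 p)) (cong (_+ + 1) (sym cr′)))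
    e-r′ : e r′ ∈λ L
    e-r′ = inI⊎inA⇒e mw R′ cr′ i⊎a
    π≡ : π (w p) ≡ π p
    π≡ with π (w p) ℕ.<? π p
    ... | no ¬lt = ℕP.≤-antisym (π-w≤π m mw) (ℕP.≮⇒≥ ¬lt)
    ... | yes lt = ⊥-elim (no-west-ascent m R cr (λ ms-r → Rim-next-s⇒¬e R′ R next ms-r e-r′) (content>⇒◁ a<p)
                                           (subst₂ _<∞_ (sym (ev-∈λ mw)) (sym (ev-∈λ m)) (fin<fin lt)))

  west-s∉C : ∀ {j p} (ndk : ¬ DownOK L π p) (W : SWWalk L π j (w p) a) → Invariant (west ndk W) → s p ∉ C
  west-s∉C {p = p} ndk W inv sC with s p ∈ᶜ? walkCells (west ndk W)
  ... | no s∉ = ℤP.<-asym (inv-rest> inv sC s∉) (content-s<content p)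
  ... | yes s∈ with ∈-++⁻ (walkCells W) s∈
  ...   | inj₂ (here eq) = ℤP.<-irrefl (cong content eq) (content-s<content p)
  ...   | inj₁ s∈W with walkCells-below W s∈W
  ...     | inj₁ eq = ℤP.<-irrefl (cong row (sym eq)) (i<i+1 (row p))
  ...     | inj₂ lt = ℤP.<-irrefl (trans (content-s p) (sym (content-w p))) lt

  west-step : ∀ {j p} (ndk : ¬ DownOK L π p) (W : SWWalk L π j (w p) a) →
              Invariant (west ndk W) → Fits p × Invariant W
  west-step {p = p} ndk W inv = fits , inv′
    where
    m = inv-∈λ inv
    a<p : content a < content p
    a<p = ℤP.≤-<-trans (subst (_≤ content (w p)) (sym (content-walk-end W)) (ℤP.i-j≤i _ _)) (content-w<content p)
    s< : s p ∈λ L → π p ℕ.< π (s p)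
    s< = west-s< ndk m (inv-es< inv) a<p
    mw : w p ∈λ L
    mw = west-∈λ W m a<p s<
    pC : p ∈ C
    pC = inv-⊆ inv (∈-++⁺ʳ (walkCells W) (here refl))
    fits : Fits p
    fits = record
      { fits-∈λ = m
      ; fits-e< = inv-e< inv
      ; fits-s< = λ ms _ → s< ms
      ; fits-e≡ = inv-e≡ inv
      ; fits-s≡ = λ sC → ⊥-elim (west-s∉C ndk W inv sC)
      }
    inv′ : Invariant W
    inv′ = record
      { inv-∈λ    = mw
      ; inv-es<   = λ mesw → subst (λ z → π (w p) ℕ.< π z) (sym (cong s (e-w p)))
                               (ℕP.≤-<-trans (π-w≤π m mw)
                                            (s< (subst (_∈λ L) (cong s (e-w p)) mesw)))
      ; inv-e<    = λ _ e∉C → ⊥-elim (e∉C (subst (_∈ C) (sym (e-w p)) pC))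
      ; inv-e≡    = west-e≡ m mw a<p pC
      ; inv-⊆     = λ m′ → inv-⊆ inv (∈-++⁺ˡ m′)
      ; inv-rest> = rest>-snoc {q = w p} (content-w<content p) (inv-rest> inv)
      }

  walk-fits : ∀ {j p} (W : SWWalk L π j p a) → Invariant W → ∀ {y} → y ∈ walkCells W → Fits y
  walk-fits stop         inv (here refl) = stop-fits inv
  walk-fits (south dk W) inv m with ∈-++⁻ (walkCells W) m
  ... | inj₁ m′         = walk-fits W (proj₂ (south-step dk W inv)) m′
  ... | inj₂ (here refl) = proj₁ (south-step dk W inv)
  walk-fits (west ndk W) inv m with ∈-++⁻ (walkCells W) m
  ... | inj₁ m′         = walk-fits W (proj₂ (west-step ndk W inv)) m′
  ... | inj₂ (here refl) = proj₁ (west-step ndk W inv)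

  fits⇒Compatible : (∀ {y} → y ∈ C → Fits y) → Compatible L P π
  fits⇒Compatible fits = (λ u m i⊎a → fits-e≡ (fits m) i⊎a) , (λ u m sC → fits-s≡ (fits m) sC)

  fits⇒IsRPP : (∀ {y} → y ∈ C → Fits y) → IsRPP L (addPath π P)
  fits⇒IsRPP fits u mu =
    addPath-≤∞ L π P mu (1≤row mu) (ℤP.≤-trans (1≤col mu) (i≤i+1 (col u)))
               (π-mono-e mu) (λ uC → fits-e< (fits uC)) ,
    addPath-≤∞ L π P mu (ℤP.≤-trans (1≤row mu) (i≤i+1 (row u))) (1≤col mu)
               (π-mono-s mu) (λ uC → fits-s< (fits uC))

_◁?_ : ∀ u v → Dec (u ◁ v)
(i , j) ◁? (k , l) = (((l - k) <? (j - i)) ⊎-dec (((j - i) ℤ.≟ (l - k)) ×-dec (k ≤? i))) ×-dec ¬? ((i , j) ≟ᶜ (k , l))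

Cand⇒∈λ : ∀ {L π u} → Cand L π u → u ∈λ L
Cand⇒∈λ (inj₁ (o , _)) = proj₁ o
Cand⇒∈λ (inj₂ (a , _)) = proj₁ a

module _ (L : List ℕ) (isP : IsPartition L) where
  open Classification L isP

  inA? : ∀ u → Dec (inA L u)
  inA? u with u ∈λ? L
  ... | no ¬m = no (λ a → ¬m (proj₁ a))
  ... | yes m with rim-of m
  ...   | r , R , cr with e r ∈λ? L | s r ∈λ? L
  ...     | yes me | no ¬s = yes (inA⇐ m R cr me ¬s)
  ...     | no ¬e  | _     = no (λ a → ¬e (proj₁ (inA⇒ m R cr a)))
  ...     | yes _  | yes ms = no (λ a → proj₂ (inA⇒ m R cr a) ms)

  Cand? : ∀ π u → Dec (Cand L π u)
  Cand? π u = (((u ∈λ? L) ×-dec (content u ∈ℤ? outerContents L)) ×-dec (ev L π (w u) <∞? ev L π u))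
            ⊎-dec (inA? u ×-dec ((ev L π (w u) <∞? ev L π u) ×-dec (ev L π (n u) <∞? ev L π u)))

walk-inserts : ∀ {L π h a} → IsPartition L → IsRPP L π → IsRimHook L h → (W : SWWalk L π (len h) (ω h) a) →
               (∀ {u} → Cand L π u → u ◁ a → ⊥) → Inserts L π h
walk-inserts {L} {π} {α₀ , hs} {a} isP rpp ((all∈ , ne) , ¬sα , ¬eω , ¬es-h) W none =
  walkPath W , (All.tabulate (λ m → fits-∈λ (fits m)) , walkPath-NE W) , ω-walkPath W , len-walkPath W ,
  fits⇒Compatible fits , fits⇒IsRPP fits
  where
  mα : α₀ ∈λ L
  mα = All.head all∈
  mω : ω (α₀ , hs) ∈λ L
  mω = All.lookup all∈ (lastOf-∈ α₀ hs)
  ¬esω : ¬ (e (s (ω (α₀ , hs))) ∈λ L)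
  ¬esω = All.lookup ¬es-h (lastOf-∈ α₀ hs)
  cα : content α₀ ≡ content a
  cα = sym (trans (content-walk-end W)
                  (trans (cong (_- + length hs) (content-lastOf α₀ hs ne)) (cancel (content α₀) (+ length hs))))
    where cancel : ∀ c k → (c + k) - k ≡ c
          cancel = solve-∀
  open Fitting L isP π rpp a none mα cα ¬sα (walkPath W)
  open Fits
  ¬I⊎A : ¬ (inI L (ω (α₀ , hs)) ⊎ inA L (ω (α₀ , hs)))
  ¬I⊎A i⊎a = ¬eω (inI⊎inA⇒e mω (Rim-¬e mω ¬eω) refl i⊎a)
  initial : Invariant W
  initial = record
    { inv-∈λ    = mω
    ; inv-es<   = λ mes → ⊥-elim (¬esω mes)
    ; inv-e<    = λ me _ → ⊥-elim (¬eω me)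
    ; inv-e≡    = λ i⊎a → ⊥-elim (¬I⊎A i⊎a)
    ; inv-⊆     = λ m → m
    ; inv-rest> = λ yC y∉ → ⊥-elim (y∉ yC)
    }
  fits : ∀ {y} → y ∈ walkCells W → Fits y
  fits = walk-fits W initial

mainTheorem5 : (λ′ : List ℕ) → IsPartition λ′ →
    (π : Cell → ℕ) → IsRPP λ′ π →
    (h : Path) → IsRimHook λ′ h → ¬ Inserts λ′ π h →
    (a : Cell) → SWWalk λ′ π (len h) (ω h) a →
    Σ Cell (λ u → Cand λ′ π u × u ◁ a)
mainTheorem5 L isP π rpp h hook ¬inserts a W
  with any? (λ u → Cand? L isP π u ×-dec (u ◁? a)) (cellsOf L)
... | yes found = satisfied found
... | no ¬found = ⊥-elim (¬inserts (walk-inserts isP rpp hook W none))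
  where
  none : ∀ {u} → Cand L π u → u ◁ a → ⊥
  none c u◁a = ¬found (lose (cellsOf-complete L (Cand⇒∈λ c)) (c , u◁a))
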